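{- For every integer $n\ge0$ and $\beta\in\mathbb{C}$, with $H_n^{\beta}=F_nE^{n\beta}F_n^{ -1}$ (a linear map on polynomials of degree at most $n$), one has $$H_n^{ -\beta}=J_nH_n^{\beta}J_n .$$
   Context: Polynomials over $\mathbb{C}$. $F_n$ is the linear map on polynomials of degree at most $n$ with $F_nx^p=(1-x)^{2n+1}\sum_{m\ge0}m^p\binom{m+n}{n}x^m$ ($0^0=1$), inverse $F_n^{ -1}x^p=\frac{n!}{(2n)!}(x)_p[x+n+1]_{n-p}$, where $(y)_p=y(y-1)\cdots(y-p+1)$, $[y]_k=y(y+1)\cdots(y+k-1)$. $E^{\gamma}c(x)=c(x+\gamma)$. $J_nc(x)=x^nc(1/x)$. -}

module Defs where

open import Level using (Level; _⊔_) renaming (suc to lsuc)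
open import Algebra.Bundles using (CommutativeRing)
open import Data.Nat as ℕ using (ℕ; zero; suc; _∸_; _!; NonZero)
open import Data.Nat.Properties using (_!≢0)
open import Data.Nat.Combinatorics using (_C_)
open import Data.Integer as ℤ using (ℤ; +_; -[1+_])
open import Data.Fin using (Fin; toℕ; opposite)
import Data.Fin as Fin
open import Data.List using (List; []; _∷_; foldr; tabulate; upTo; map)
open import Relation.Nullary using (¬_)

module _ {c ℓ : Level} (R : CommutativeRing c ℓ) where
  open CommutativeRing R hiding (zero)

  ℕ→R : ℕ → Carrier
  ℕ→R zero    = 0#
  ℕ→R (suc k) = 1# + ℕ→R k

  ℤ→R : ℤ → Carrier
  ℤ→R (+ k)      = ℕ→R k
  ℤ→R -[1+ k ]   = - ℕ→R (suc k)

-- A field of characteristic zero (ℂ is one; stdlib has no ℂ).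
record CharZeroField (c ℓ : Level) : Set (lsuc (c ⊔ ℓ)) where
  field
    cring : CommutativeRing c ℓ
  open CommutativeRing cring hiding (ring)
  field
    inv      : (x : Carrier) → ¬ (x ≈ 0#) → Carrier
    inv-l    : ∀ x (x≉0 : ¬ (x ≈ 0#)) → inv x x≉0 * x ≈ 1#
    charZero : ∀ k → .{{_ : NonZero k}} → ¬ (ℕ→R cring k ≈ 0#)

module Poly {c ℓ : Level} (𝔽 : CharZeroField c ℓ) where
  open CharZeroField 𝔽
  open CommutativeRing cring hiding (ring; zero)

  -- An element of the space of polynomials of degree ≤ n: its
  -- coefficient vector (c₀ , … , cₙ), i.e. c(x) = Σ_p c_p x^p.
  P≤ : ℕ → Set c
  P≤ n = Fin (suc n) → Carrier

  -- Full polynomials as coefficient lists (constant term first).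
  Pol : Set c
  Pol = List Carrier

  coeff : Pol → ℕ → Carrier
  coeff []       _       = 0#
  coeff (a ∷ _)  zero    = a
  coeff (_ ∷ as) (suc k) = coeff as k

  _+P_ : Pol → Pol → Pol
  []       +P q        = q
  p        +P []       = p
  (a ∷ as) +P (b ∷ bs) = (a + b) ∷ (as +P bs)

  scale : Carrier → Pol → Pol
  scale a = map (a *_)

  _*P_ : Pol → Pol → Pol
  []       *P q = []
  (a ∷ as) *P q = scale a q +P (0# ∷ (as *P q))

  constP : Carrier → Pol
  constP a = a ∷ []

  xPlus : Carrier → Pol
  xPlus a = a ∷ 1# ∷ []

  prodP : List Pol → Pol
  prodP = foldr _*P_ (constP 1#)

  sumF : ∀ {n} → (Fin n → Carrier) → Carrier
  sumF {zero}  f = 0#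
  sumF {suc n} f = f Fin.zero + sumF (λ i → f (Fin.suc i))

  sumℤ : ℕ → (ℕ → ℤ) → ℤ
  sumℤ zero    f = f zero
  sumℤ (suc k) f = sumℤ k f ℤ.+ f (suc k)

  toP≤ : (n : ℕ) → Pol → P≤ n
  toP≤ n p k = coeff p (toℕ k)

  fromP≤ : ∀ {n} → P≤ n → Pol
  fromP≤ {n} c = tabulate c

  compose : Pol → Pol → Pol
  compose p q = foldr (λ a acc → constP a +P (q *P acc)) [] p

  E : ∀ {n} → Carrier → P≤ n → P≤ n
  E {n} γ c = toP≤ n (compose (fromP≤ c) (xPlus γ))

  -- J_n c(x) = x^n c(1/x): coefficient of x^k is c_{n-k}
  J : ∀ n → P≤ n → P≤ n
  J n c k = c (opposite k)

  -- Coefficient of x^k in F_n x^p = (1-x)^{2n+1} Σ_m m^p C(m+n,n) x^m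
  -- (Cauchy product; ℕ exponent has 0^0 = 1):
  --   Σ_{j=0}^{k} (-1)^j C(2n+1,j) (k-j)^p C(k-j+n,n)
  Fcoeff : ℕ → ℕ → ℕ → ℤ
  Fcoeff n p k = sumℤ k (λ j → sgn j ℤ.* (+ ((suc (2 ℕ.* n) C j)
                    ℕ.* ((k ∸ j) ℕ.^ p) ℕ.* ((k ∸ j ℕ.+ n) C n))))
    where
      sgn : ℕ → ℤ
      sgn zero          = + 1
      sgn (suc zero)    = ℤ.- (+ 1)
      sgn (suc (suc j)) = sgn j

  F : ∀ n → P≤ n → P≤ n
  F n c k = sumF (λ p → c p * ℤ→R cring (Fcoeff n (toℕ p) (toℕ k)))

  ratio : ℕ → Carrier
  ratio n = ℕ→R cring (n !) *
            inv (ℕ→R cring ((2 ℕ.* n) !)) (charZero ((2 ℕ.* n) !) {{(2 ℕ.* n) !≢0}})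

  falling : ℕ → Pol
  falling p = prodP (map (λ i → xPlus (- ℕ→R cring i)) (upTo p))

  rising : Carrier → ℕ → Pol
  rising a k = prodP (map (λ i → xPlus (a + ℕ→R cring i)) (upTo k))

  FinvBasis : ℕ → ℕ → Pol
  FinvBasis n p = scale (ratio n) (falling p *P rising (ℕ→R cring (suc n)) (n ∸ p))

  Finv : ∀ n → P≤ n → P≤ n
  Finv n c k = sumF (λ p → c p * coeff (FinvBasis n (toℕ p)) (toℕ k))

  H : ∀ n → Carrier → P≤ n → P≤ n
  H n β c = F n (E (ℕ→R cring n * β) (Finv n c))

{-# OPTIONS --safe #-}
module Submission where

-- For a function G put Fsum n G K = Σ_{j≤K} (-1)^j C(2n+1,j) C(K-j+n,n) G(K-j), the coefficient
-- of x^K in (1-x)^{2n+1} Σ_m C(m+n,n) G(m) x^m; so (F_n c)_K = Fsum n c K.  If G is a polynomial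
-- of degree ≤ n, then R(y)·G(y) with R(y) = (y+1)⋯(y+n) has degree ≤ 2n, and its (2n+1)-st
-- backward difference at K vanishes.  In that alternating sum the terms j ≤ K give n!·Fsum n G K
-- (as R(m) = n! C(m+n,n)), the next n terms vanish at the roots of R, and the last n-K+1 terms,
-- read backwards and using R(-y-n-1) = (-1)^n R(y), give -(-1)^n n!·Fsum n G′ (n-K) with
-- G′(y) = G(-y-n-1).  Hence Fsum n G K = (-1)^n Fsum n G′ (n-K).  The product formula for F_n^{-1}
-- gives (F_n^{-1} J_n c)(y) = (-1)^n (F_n^{-1} c)(-y-n-1), and E^γ translates by γ; applied to
-- G = E^{-nβ} F_n^{-1} p this is the theorem, coefficient by coefficient.

open import Defs
open import Level using (Level)
open import Data.Nat using (ℕ)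
open import Data.Fin using (Fin)
open import Data.List using ([]; _∷_; map; tabulate; length; applyUpTo)
import Data.List.Properties as List
open import Algebra.Bundles using (CommutativeRing)

open import Data.Nat as ℕ using (zero; suc; _∸_; _!)
import Data.Nat.Properties as ℕ
open import Data.Nat.Combinatorics using (_C_; nCk+nC[k+1]≡[n+1]C[k+1]; nC1≡n; k>n⇒nCk≡0; nCk≡nC[n∸k])
open import Data.Nat.Tactic.RingSolver using (solve-∀)
open import Data.Integer as ℤ using (ℤ; +_; -[1+_])
import Data.Integer.Properties as ℤ
import Data.Fin as Fin
import Data.Fin.Properties as Fin
import Data.Fin.Permutation as Permutation
import Data.Sign as Sign
open import Data.Maybe using (Maybe; nothing; just)
open import Data.Product using (∃; _,_; proj₁)
open import Relation.Binary.PropositionalEquality as ≡ using (_≡_)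
open import Relation.Nullary using (yes; no; ¬_)
open import Relation.Binary.Core using (_Preserves_⟶_)
open import Function using (_∘_)
import Algebra.Solver.Ring
import Algebra.Solver.Ring.AlmostCommutativeRing as ACR

[1+k]*[1+n]C[1+k]≡[1+n]*nCk : ∀ n k → suc k ℕ.* (suc n C suc k) ≡ suc n ℕ.* (n C k)
[1+k]*[1+n]C[1+k]≡[1+n]*nCk zero    zero    = ≡.refl
[1+k]*[1+n]C[1+k]≡[1+n]*nCk zero    (suc k) = ℕ.*-zeroʳ (2 ℕ.+ k)
[1+k]*[1+n]C[1+k]≡[1+n]*nCk (suc n) zero    = ≡.trans (ℕ.+-identityʳ _) (≡.trans (nC1≡n (2 ℕ.+ n)) (≡.sym (ℕ.*-identityʳ _)))
[1+k]*[1+n]C[1+k]≡[1+n]*nCk (suc n) (suc k) = begin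
  (2 ℕ.+ k) ℕ.* (suc (suc n) C (2 ℕ.+ k))            ≡⟨ ≡.cong ((2 ℕ.+ k) ℕ.*_) (nCk+nC[k+1]≡[n+1]C[k+1] (suc n) (suc k)) ⟨
  (2 ℕ.+ k) ℕ.* (A ℕ.+ B)                            ≡⟨ split (suc k) A B ⟩
  A ℕ.+ (suc k ℕ.* A ℕ.+ (2 ℕ.+ k) ℕ.* B)           ≡⟨ ≡.cong₂ (λ u v → A ℕ.+ (u ℕ.+ v)) ([1+k]*[1+n]C[1+k]≡[1+n]*nCk n k) ([1+k]*[1+n]C[1+k]≡[1+n]*nCk n (suc k)) ⟩
  A ℕ.+ (suc n ℕ.* (n C k) ℕ.+ suc n ℕ.* (n C suc k)) ≡⟨ ≡.cong (A ℕ.+_) (≡.sym (ℕ.*-distribˡ-+ (suc n) (n C k) _)) ⟩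
  A ℕ.+ suc n ℕ.* (n C k ℕ.+ n C suc k)              ≡⟨ ≡.cong (λ u → A ℕ.+ suc n ℕ.* u) (nCk+nC[k+1]≡[n+1]C[k+1] n k) ⟩
  A ℕ.+ suc n ℕ.* A                                  ∎
  where
  open ≡.≡-Reasoning
  A = suc n C suc k
  B = suc n C suc (suc k)
  split : ∀ k a b → suc k ℕ.* (a ℕ.+ b) ≡ a ℕ.+ (k ℕ.* a ℕ.+ suc k ℕ.* b)
  split = solve-∀

n!*[m+n]Cn*[1+m+n]≡[1+n]!*[m+1+n]C[1+n] : ∀ m n →
  n ! ℕ.* ((m ℕ.+ n) C n) ℕ.* suc (m ℕ.+ n) ≡ suc n ! ℕ.* ((m ℕ.+ suc n) C suc n)
n!*[m+n]Cn*[1+m+n]≡[1+n]!*[m+1+n]C[1+n] m n = begin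
  n ! ℕ.* c ℕ.* suc (m ℕ.+ n)                       ≡⟨ reassoc (n !) c (suc (m ℕ.+ n)) ⟩
  n ! ℕ.* (suc (m ℕ.+ n) ℕ.* c)                     ≡⟨ ≡.cong (n ! ℕ.*_) ([1+k]*[1+n]C[1+k]≡[1+n]*nCk (m ℕ.+ n) n) ⟨
  n ! ℕ.* (suc n ℕ.* (suc (m ℕ.+ n) C suc n))       ≡⟨ ≡.sym (ℕ.*-assoc (n !) (suc n) _) ⟩
  n ! ℕ.* suc n ℕ.* (suc (m ℕ.+ n) C suc n)         ≡⟨ ≡.cong₂ (λ u v → u ℕ.* (v C suc n)) (ℕ.*-comm (suc n) (n !)) (ℕ.+-suc m n) ⟨
  suc n ! ℕ.* ((m ℕ.+ suc n) C suc n)               ∎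
  where
  open ≡.≡-Reasoning
  c = (m ℕ.+ n) C n
  reassoc : ∀ a b d → a ℕ.* b ℕ.* d ≡ a ℕ.* (d ℕ.* b)
  reassoc = solve-∀

i+j≡n⇒nCi≡nCj : ∀ {i j n} → i ℕ.+ j ≡ n → n C i ≡ n C j
i+j≡n⇒nCi≡nCj {i} {j} ≡.refl = ≡.trans (nCk≡nC[n∸k] (ℕ.m≤m+n i j)) (≡.cong ((i ℕ.+ j) C_) (ℕ.m+n∸m≡n i j))

[1+K]+[n+[r∸i]]+i≡1+2n : ∀ {K r n i} → K ℕ.+ r ≡ n → i ℕ.≤ r → suc K ℕ.+ (n ℕ.+ (r ∸ i)) ℕ.+ i ≡ suc (2 ℕ.* n)
[1+K]+[n+[r∸i]]+i≡1+2n {K} {r} {i = i} ≡.refl i≤r = begin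
  suc K ℕ.+ ((K ℕ.+ r) ℕ.+ (r ∸ i)) ℕ.+ i  ≡⟨ reassoc (suc K) (K ℕ.+ r) (r ∸ i) i ⟩
  suc K ℕ.+ (K ℕ.+ r) ℕ.+ (r ∸ i ℕ.+ i)    ≡⟨ ≡.cong (suc K ℕ.+ (K ℕ.+ r) ℕ.+_) (ℕ.m∸n+n≡m i≤r) ⟩
  suc K ℕ.+ (K ℕ.+ r) ℕ.+ r                ≡⟨ regroup K r ⟩
  suc (2 ℕ.* (K ℕ.+ r))                    ∎
  where
  open ≡.≡-Reasoning
  reassoc : ∀ a b c d → a ℕ.+ (b ℕ.+ c) ℕ.+ d ≡ a ℕ.+ b ℕ.+ (c ℕ.+ d)
  reassoc = solve-∀
  regroup : ∀ k s → suc k ℕ.+ (k ℕ.+ s) ℕ.+ s ≡ suc (2 ℕ.* (k ℕ.+ s))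
  regroup = solve-∀

2+2n≡[1+K]+[n+[1+r]] : ∀ {K r n} → K ℕ.+ r ≡ n → suc (suc (2 ℕ.* n)) ≡ suc K ℕ.+ (n ℕ.+ suc r)
2+2n≡[1+K]+[n+[1+r]] {K} {r} ≡.refl = regroup K r
  where
  regroup : ∀ k s → suc (suc (2 ℕ.* (k ℕ.+ s))) ≡ suc k ℕ.+ ((k ℕ.+ s) ℕ.+ suc s)
  regroup = solve-∀

parity-induction : ∀ {a} (P : ℕ → Set a) → P 0 → P 1 → (∀ j → P j → P (suc (suc j))) → ∀ j → P j
parity-induction P p₀ p₁ step zero          = p₀
parity-induction P p₀ p₁ step (suc zero)    = p₁
parity-induction P p₀ p₁ step (suc (suc j)) = step j (parity-induction P p₀ p₁ step j)


module Embeddings {c ℓ : Level} (R : CommutativeRing c ℓ) where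
  open CommutativeRing R hiding (zero)
  open import Algebra.Properties.Ring ring using (-‿distribˡ-*; -‿distribʳ-*; -‿involutive; -0#≈0#; -‿+-comm)
  open import Relation.Binary.Reasoning.Setoid setoid

  ι : ℕ → Carrier
  ι = ℕ→R R

  ιℤ : ℤ → Carrier
  ιℤ = ℤ→R R

  ι-1 : ι 1 ≈ 1#
  ι-1 = +-identityʳ 1#

  ι-+ : ∀ m n → ι (m ℕ.+ n) ≈ ι m + ι n
  ι-+ zero    n = sym (+-identityˡ _)
  ι-+ (suc m) n = trans (+-congˡ (ι-+ m n)) (sym (+-assoc _ _ _))

  ι-* : ∀ m n → ι (m ℕ.* n) ≈ ι m * ι n
  ι-* zero    n = sym (zeroˡ _)
  ι-* (suc m) n = begin
    ι (n ℕ.+ m ℕ.* n)     ≈⟨ ι-+ n (m ℕ.* n) ⟩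
    ι n + ι (m ℕ.* n)     ≈⟨ +-cong (sym (*-identityˡ _)) (ι-* m n) ⟩
    1# * ι n + ι m * ι n  ≈⟨ distribʳ _ _ _ ⟨
    ι (suc m) * ι n       ∎

  ιℤ-neg : ∀ i → ιℤ (ℤ.- i) ≈ - ιℤ i
  ιℤ-neg -[1+ n ]   = sym (-‿involutive _)
  ιℤ-neg (+ zero)   = sym -0#≈0#
  ιℤ-neg (+ suc n)  = refl

  ιℤ-⊖ : ∀ m n → ιℤ (m ℤ.⊖ n) ≈ ι m - ι n
  ιℤ-⊖ m       zero    = begin
    ιℤ (m ℤ.⊖ 0)  ≡⟨ ≡.cong ιℤ (ℤ.⊖-≥ {m} ℕ.z≤n) ⟩
    ι m           ≈⟨ +-identityʳ _ ⟨
    ι m + 0#      ≈⟨ +-congˡ -0#≈0# ⟨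
    ι m - 0#      ∎
  ιℤ-⊖ zero    (suc n) = begin
    ιℤ (0 ℤ.⊖ suc n)  ≡⟨ ≡.cong ιℤ (ℤ.⊖-< {0} {suc n} (ℕ.s≤s ℕ.z≤n)) ⟩
    - ι (suc n)       ≈⟨ +-identityˡ _ ⟨
    0# - ι (suc n)    ∎
  ιℤ-⊖ (suc m) (suc n) = begin
    ιℤ (suc m ℤ.⊖ suc n)              ≡⟨ ≡.cong ιℤ (ℤ.[1+m]⊖[1+n]≡m⊖n m n) ⟩
    ιℤ (m ℤ.⊖ n)                      ≈⟨ ιℤ-⊖ m n ⟩
    ι m - ι n                         ≈⟨ a-b≈[1+a]+[-1+-b] (ι m) (ι n) ⟩
    (1# + ι m) + (- 1# + - ι n)       ≈⟨ +-congˡ (-‿+-comm _ _) ⟩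
    (1# + ι m) - (1# + ι n)           ∎
    where
    a-b≈[1+a]+[-1+-b] : ∀ a b → a - b ≈ (1# + a) + (- 1# + - b)
    a-b≈[1+a]+[-1+-b] a b = begin
      a - b                      ≈⟨ +-identityˡ _ ⟨
      0# + (a - b)               ≈⟨ +-congʳ (-‿inverseʳ 1#) ⟨
      (1# - 1#) + (a - b)        ≈⟨ +-assoc _ _ _ ⟩
      1# + (- 1# + (a - b))      ≈⟨ +-congˡ (+-assoc _ _ _) ⟨
      1# + ((- 1# + a) - b)      ≈⟨ +-congˡ (+-congʳ (+-comm _ _)) ⟩
      1# + ((a + - 1#) - b)      ≈⟨ +-congˡ (+-assoc _ _ _) ⟩
      1# + (a + (- 1# - b))      ≈⟨ +-assoc _ _ _ ⟨
      (1# + a) + (- 1# + - b)    ∎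

  ιℤ-+ : ∀ i j → ιℤ (i ℤ.+ j) ≈ ιℤ i + ιℤ j
  ιℤ-+ (+ m)    (+ n)    = ι-+ m n
  ιℤ-+ (+ m)    -[1+ n ] = ιℤ-⊖ m (suc n)
  ιℤ-+ -[1+ m ] (+ n)    = trans (ιℤ-⊖ n (suc m)) (+-comm _ _)
  ιℤ-+ -[1+ m ] -[1+ n ] = begin
    - ι (suc (suc (m ℕ.+ n)))         ≡⟨ ≡.cong (λ k → - ι k) (≡.cong suc (ℕ.+-suc m n)) ⟨
    - ι (suc m ℕ.+ suc n)             ≈⟨ -‿cong (ι-+ (suc m) (suc n)) ⟩
    - (ι (suc m) + ι (suc n))         ≈⟨ -‿+-comm _ _ ⟨
    - ι (suc m) + - ι (suc n)         ∎

  ιℤ-◃-pos : ∀ n → ιℤ (Sign.+ ℤ.◃ n) ≈ ι n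
  ιℤ-◃-pos n = reflexive (≡.cong ιℤ (ℤ.+◃n≡+n n))

  ιℤ-◃-neg : ∀ n → ιℤ (Sign.- ℤ.◃ n) ≈ - ι n
  ιℤ-◃-neg n = trans (reflexive (≡.cong ιℤ (ℤ.-◃n≡-n n))) (ιℤ-neg (+ n))

  ιℤ-* : ∀ i j → ιℤ (i ℤ.* j) ≈ ιℤ i * ιℤ j
  ιℤ-* (+ m)    (+ n)    = trans (ιℤ-◃-pos (m ℕ.* n)) (ι-* m n)
  ιℤ-* (+ m)    -[1+ n ] = trans (ιℤ-◃-neg (m ℕ.* suc n)) (trans (-‿cong (ι-* m (suc n))) (-‿distribʳ-* _ _))
  ιℤ-* -[1+ m ] (+ n)    = trans (ιℤ-◃-neg (suc m ℕ.* n)) (trans (-‿cong (ι-* (suc m) n)) (-‿distribˡ-* _ _))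
  ιℤ-* -[1+ m ] -[1+ n ] = begin
    ιℤ (Sign.+ ℤ.◃ suc m ℕ.* suc n)  ≈⟨ ιℤ-◃-pos (suc m ℕ.* suc n) ⟩
    ι (suc m ℕ.* suc n)              ≈⟨ ι-* (suc m) (suc n) ⟩
    ι (suc m) * ι (suc n)            ≈⟨ -‿involutive _ ⟨
    - - (ι (suc m) * ι (suc n))      ≈⟨ -‿cong (-‿distribʳ-* _ _) ⟩
    - (ι (suc m) * - ι (suc n))      ≈⟨ -‿distribˡ-* _ _ ⟩
    - ι (suc m) * - ι (suc n)        ∎

  -- With ℤ coefficients the ring solver can decide when coefficients cancel.
  ιℤ-homomorphism : ACR._-Raw-AlmostCommutative⟶_ (CommutativeRing.rawRing ℤ.+-*-commutativeRing) (ACR.fromCommutativeRing R)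
  ιℤ-homomorphism = record
    { ⟦_⟧ = ιℤ ; +-homo = ιℤ-+ ; *-homo = ιℤ-* ; -‿homo = ιℤ-neg ; 0-homo = refl ; 1-homo = ι-1 }

  ιℤ-weaklyDecidable : ∀ i j → Maybe (ιℤ i ≈ ιℤ j)
  ιℤ-weaklyDecidable i j with i ℤ.≟ j
  ... | yes i≡j = just (reflexive (≡.cong ιℤ i≡j))
  ... | no  _   = nothing

  module ℤ-Solver = Algebra.Solver.Ring
    (CommutativeRing.rawRing ℤ.+-*-commutativeRing) (ACR.fromCommutativeRing R) ιℤ-homomorphism ιℤ-weaklyDecidable

module FiniteSumsAndProducts {c ℓ : Level} (R : CommutativeRing c ℓ) where
  open CommutativeRing R hiding (zero)
  open import Algebra.Properties.Semiring.Exp semiring public using (_^_; ^-homo-*; ^-congˡ)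
  open import Algebra.Properties.Ring ring using (-1*x≈-x; -‿involutive)
  open import Algebra.Properties.CommutativeMonoid.Sum +-commutativeMonoid using (sum-syntax; sum-replicate-zero; ∑-distrib-+)
  open import Relation.Binary.Reasoning.Setoid setoid
  open Embeddings R
  open ℤ-Solver using (solve; _:+_; _:*_; :-_; _:=_)

  sign : ℕ → Carrier
  sign j = (- 1#) ^ j

  sign-suc : ∀ j → sign (suc j) ≈ - sign j
  sign-suc j = -1*x≈-x (sign j)

  sign-suc-suc : ∀ j → sign (suc (suc j)) ≈ sign j
  sign-suc-suc j = trans (sign-suc (suc j)) (trans (-‿cong (sign-suc j)) (-‿involutive _))

  sign-+ : ∀ i j → sign (i ℕ.+ j) ≈ sign i * sign j
  sign-+ = ^-homo-* (- 1#)

  sign-square : ∀ j → sign j * sign j ≈ 1#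
  sign-square zero    = *-identityˡ 1#
  sign-square (suc j) = begin
    sign (suc j) * sign (suc j)  ≈⟨ *-cong (sign-suc j) (sign-suc j) ⟩
    - sign j * - sign j          ≈⟨ solve 1 (λ s → (:- s) :* (:- s) := s :* s) refl (sign j) ⟩
    sign j * sign j              ≈⟨ sign-square j ⟩
    1#                           ∎

  sign-odd : ∀ n → sign (suc (2 ℕ.* n)) ≈ - 1#
  sign-odd n = begin
    sign (suc (n ℕ.+ (n ℕ.+ 0)))  ≈⟨ sign-suc (n ℕ.+ (n ℕ.+ 0)) ⟩
    - sign (n ℕ.+ (n ℕ.+ 0))      ≡⟨ ≡.cong (λ m → - sign (n ℕ.+ m)) (ℕ.+-identityʳ n) ⟩
    - sign (n ℕ.+ n)              ≈⟨ -‿cong (trans (sign-+ n n) (sign-square n)) ⟩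
    - 1#                          ∎

  sign-odd-complement : ∀ {i j n} → j ℕ.+ i ≡ suc (2 ℕ.* n) → sign j ≈ - sign i
  sign-odd-complement {i} {j} {n} j+i≡odd = begin
    sign j                         ≈⟨ *-identityʳ _ ⟨
    sign j * 1#                    ≈⟨ *-congˡ (sign-square i) ⟨
    sign j * (sign i * sign i)     ≈⟨ *-assoc _ _ _ ⟨
    sign j * sign i * sign i       ≈⟨ *-congʳ (sign-+ j i) ⟨
    sign (j ℕ.+ i) * sign i        ≡⟨ ≡.cong (λ m → sign m * sign i) j+i≡odd ⟩
    sign (suc (2 ℕ.* n)) * sign i  ≈⟨ *-congʳ (sign-odd n) ⟩
    - 1# * sign i                  ≈⟨ -1*x≈-x (sign i) ⟩
    - sign i                       ∎

  sumTo : ℕ → (ℕ → Carrier) → Carrier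
  sumTo zero    f = 0#
  sumTo (suc M) f = sumTo M f + f M

  sumTo-cong : ∀ M {f g : ℕ → Carrier} → (∀ j → j ℕ.< M → f j ≈ g j) → sumTo M f ≈ sumTo M g
  sumTo-cong zero    f≈g = refl
  sumTo-cong (suc M) f≈g = +-cong (sumTo-cong M (λ j j<M → f≈g j (ℕ.m<n⇒m<1+n j<M))) (f≈g M (ℕ.n<1+n M))

  sumTo-zero : ∀ M {f : ℕ → Carrier} → (∀ j → j ℕ.< M → f j ≈ 0#) → sumTo M f ≈ 0#
  sumTo-zero M f≈0 = trans (sumTo-cong M f≈0) (zeros M)
    where
    zeros : ∀ M → sumTo M (λ _ → 0#) ≈ 0#
    zeros zero    = refl
    zeros (suc M) = trans (+-identityʳ _) (zeros M)

  sumTo-distrib-+ : ∀ M (f g : ℕ → Carrier) → sumTo M (λ j → f j + g j) ≈ sumTo M f + sumTo M g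
  sumTo-distrib-+ zero    f g = sym (+-identityˡ 0#)
  sumTo-distrib-+ (suc M) f g = trans (+-congʳ (sumTo-distrib-+ M f g))
    (solve 4 (λ a b c d → (a :+ b) :+ (c :+ d) := (a :+ c) :+ (b :+ d)) refl _ _ _ _)

  *-distribˡ-sumTo : ∀ M a (f : ℕ → Carrier) → a * sumTo M f ≈ sumTo M (λ j → a * f j)
  *-distribˡ-sumTo zero    a f = zeroʳ a
  *-distribˡ-sumTo (suc M) a f = trans (distribˡ a _ _) (+-congʳ (*-distribˡ-sumTo M a f))

  sumTo-suc : ∀ M (f : ℕ → Carrier) → sumTo (suc M) f ≈ f 0 + sumTo M (λ j → f (suc j))
  sumTo-suc zero    f = trans (+-identityˡ _) (sym (+-identityʳ _))
  sumTo-suc (suc M) f = trans (+-congʳ (sumTo-suc M f)) (+-assoc _ _ _)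

  sumTo-+ : ∀ a b (f : ℕ → Carrier) → sumTo (a ℕ.+ b) f ≈ sumTo a f + sumTo b (λ j → f (a ℕ.+ j))
  sumTo-+ a zero    f = trans (reflexive (≡.cong (λ m → sumTo m f) (ℕ.+-identityʳ a))) (sym (+-identityʳ _))
  sumTo-+ a (suc b) f = begin
    sumTo (a ℕ.+ suc b) f                                ≡⟨ ≡.cong (λ m → sumTo m f) (ℕ.+-suc a b) ⟩
    sumTo (a ℕ.+ b) f + f (a ℕ.+ b)                      ≈⟨ +-congʳ (sumTo-+ a b f) ⟩
    (sumTo a f + sumTo b (λ j → f (a ℕ.+ j))) + f (a ℕ.+ b) ≈⟨ +-assoc _ _ _ ⟩
    sumTo a f + sumTo (suc b) (λ j → f (a ℕ.+ j))        ∎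

  sumTo-reverse : ∀ M (f : ℕ → Carrier) → sumTo M f ≈ sumTo M (λ j → f (M ∸ suc j))
  sumTo-reverse zero    f = refl
  sumTo-reverse (suc M) f = begin
    sumTo M f + f M                                ≈⟨ +-comm _ _ ⟩
    f M + sumTo M f                                ≈⟨ +-congˡ (sumTo-reverse M f) ⟩
    f M + sumTo M (λ j → f (M ∸ suc j))            ≈⟨ sumTo-suc M (λ j → f (suc M ∸ suc j)) ⟨
    sumTo (suc M) (λ j → f (suc M ∸ suc j))        ∎

  ∑-sumTo-comm : ∀ {m} M (t : Fin m → ℕ → Carrier) → ∑[ i < m ] sumTo M (t i) ≈ sumTo M (λ j → ∑[ i < m ] t i j)
  ∑-sumTo-comm {m} zero    t = sum-replicate-zero m
  ∑-sumTo-comm {m} (suc M) t = trans (∑-distrib-+ (λ i → sumTo M (t i)) (λ i → t i M)) (+-congʳ (∑-sumTo-comm M t))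

  prodTo : ℕ → (ℕ → Carrier) → Carrier
  prodTo zero    f = 1#
  prodTo (suc M) f = f 0 * prodTo M (λ i → f (suc i))

  prodTo-cong : ∀ M {f g : ℕ → Carrier} → (∀ i → i ℕ.< M → f i ≈ g i) → prodTo M f ≈ prodTo M g
  prodTo-cong zero    f≈g = refl
  prodTo-cong (suc M) f≈g = *-cong (f≈g 0 (ℕ.s≤s ℕ.z≤n)) (prodTo-cong M (λ i i<M → f≈g (suc i) (ℕ.s≤s i<M)))

  prodTo-zero : ∀ M {f : ℕ → Carrier} i → i ℕ.< M → f i ≈ 0# → prodTo M f ≈ 0#
  prodTo-zero (suc M) zero    _              fi≈0 = trans (*-congʳ fi≈0) (zeroˡ _)
  prodTo-zero (suc M) (suc i) (ℕ.s≤s i<M) fi≈0 = trans (*-congˡ (prodTo-zero M i i<M fi≈0)) (zeroʳ _)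

  prodTo-neg : ∀ M (f : ℕ → Carrier) → prodTo M (λ i → - f i) ≈ sign M * prodTo M f
  prodTo-neg zero    f = sym (*-identityˡ 1#)
  prodTo-neg (suc M) f = begin
    - f 0 * prodTo M (λ i → - f (suc i))          ≈⟨ *-congˡ (prodTo-neg M (λ i → f (suc i))) ⟩
    - f 0 * (sign M * prodTo M (λ i → f (suc i))) ≈⟨ solve 3 (λ a s p → (:- a) :* (s :* p) := (:- s) :* (a :* p)) refl _ _ _ ⟩
    - sign M * prodTo (suc M) f                   ≈⟨ *-congʳ (sign-suc M) ⟨
    sign (suc M) * prodTo (suc M) f               ∎

  prodTo-last : ∀ M (f : ℕ → Carrier) → prodTo (suc M) f ≈ prodTo M f * f M
  prodTo-last zero    f = *-comm _ _
  prodTo-last (suc M) f = trans (*-congˡ (prodTo-last M (λ i → f (suc i)))) (sym (*-assoc _ _ _))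

  prodTo-reverse : ∀ M (f : ℕ → Carrier) → prodTo M f ≈ prodTo M (λ i → f (M ∸ suc i))
  prodTo-reverse zero    f = refl
  prodTo-reverse (suc M) f = begin
    prodTo (suc M) f                       ≈⟨ prodTo-last M f ⟩
    prodTo M f * f M                       ≈⟨ *-congʳ (prodTo-reverse M f) ⟩
    prodTo M (λ i → f (M ∸ suc i)) * f M   ≈⟨ *-comm _ _ ⟩
    prodTo (suc M) (λ i → f (suc M ∸ suc i)) ∎

module FiniteDifferences {c ℓ : Level} (R : CommutativeRing c ℓ) where
  open CommutativeRing R hiding (zero)
  open import Algebra.Properties.Ring ring using (-0#≈0#; -1*x≈-x)
  open import Algebra.Properties.CommutativeMonoid.Sum +-commutativeMonoid using (sum)
  open import Relation.Binary.Reasoning.Setoid setoid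
  open Embeddings R
  open FiniteSumsAndProducts R
  open ℤ-Solver using (solve; _:+_; _:-_; _:*_; :-_; _:=_)

  Δ : (Carrier → Carrier) → Carrier → Carrier
  Δ f x = f x - f (x - 1#)

  Δ^ : ℕ → (Carrier → Carrier) → Carrier → Carrier
  Δ^ zero    f = f
  Δ^ (suc M) f = Δ^ M (Δ f)

  DegreeBelow : ℕ → (Carrier → Carrier) → Set (c Level.⊔ ℓ)
  DegreeBelow M f = ∀ x → Δ^ M f x ≈ 0#

  Δ^-cong : ∀ M {f g : Carrier → Carrier} → (∀ y → f y ≈ g y) → ∀ x → Δ^ M f x ≈ Δ^ M g x
  Δ^-cong zero    f≈g = f≈g
  Δ^-cong (suc M) f≈g = Δ^-cong M (λ y → +-cong (f≈g y) (-‿cong (f≈g (y - 1#))))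

  Δ^-+ : ∀ M (f g : Carrier → Carrier) x → Δ^ M (λ y → f y + g y) x ≈ Δ^ M f x + Δ^ M g x
  Δ^-+ zero    f g x = refl
  Δ^-+ (suc M) f g x = trans
    (Δ^-cong M (λ y → solve 4 (λ a b c d → (a :+ b) :- (c :+ d) := (a :- c) :+ (b :- d)) refl (f y) (g y) (f (y - 1#)) (g (y - 1#))) x)
    (Δ^-+ M (Δ f) (Δ g) x)

  Δ^-*ˡ : ∀ M a (f : Carrier → Carrier) x → Δ^ M (λ y → a * f y) x ≈ a * Δ^ M f x
  Δ^-*ˡ zero    a f x = refl
  Δ^-*ˡ (suc M) a f x = trans
    (Δ^-cong M (λ y → solve 3 (λ a b c → a :* b :- a :* c := a :* (b :- c)) refl a (f y) (f (y - 1#))) x)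
    (Δ^-*ˡ M a (Δ f) x)

  Δ^-shift : ∀ M (f : Carrier → Carrier) x → Δ^ M (λ y → f (y - 1#)) x ≈ Δ^ M f (x - 1#)
  Δ^-shift zero    f x = refl
  Δ^-shift (suc M) f x = Δ^-shift M (Δ f) x

  DegreeBelow-cong : ∀ {M f g} → (∀ y → f y ≈ g y) → DegreeBelow M f → DegreeBelow M g
  DegreeBelow-cong {M} f≈g df x = trans (sym (Δ^-cong M f≈g x)) (df x)

  DegreeBelow-+ : ∀ {M f g} → DegreeBelow M f → DegreeBelow M g → DegreeBelow M (λ y → f y + g y)
  DegreeBelow-+ {M} {f} {g} df dg x = trans (Δ^-+ M f g x) (trans (+-cong (df x) (dg x)) (+-identityˡ 0#))

  DegreeBelow-*ˡ : ∀ {M f} a → DegreeBelow M f → DegreeBelow M (λ y → a * f y)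
  DegreeBelow-*ˡ {M} {f} a df x = trans (Δ^-*ˡ M a f x) (trans (*-congˡ (df x)) (zeroʳ a))

  DegreeBelow-sum : ∀ {M m} (h : Fin m → Carrier → Carrier) → (∀ p → DegreeBelow M (h p)) →
                    DegreeBelow M (λ y → sum (λ p → h p y))
  DegreeBelow-sum {M} {zero}  h dh = zeros M
    where
    zeros : ∀ M x → Δ^ M (λ _ → 0#) x ≈ 0#
    zeros zero    x = refl
    zeros (suc M) x = trans (Δ^-cong M (λ _ → -‿inverseʳ 0#) x) (zeros M x)
  DegreeBelow-sum {M} {suc m} h dh = DegreeBelow-+ {M} (dh Fin.zero) (DegreeBelow-sum {M} (h ∘ Fin.suc) (dh ∘ Fin.suc))

  DegreeBelow-suc : ∀ {M f} → DegreeBelow M f → DegreeBelow (suc M) f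
  DegreeBelow-suc {M} {f} df x = begin
    Δ^ M (Δ f) x                                    ≈⟨ Δ^-cong M (λ y → +-congˡ (sym (-1*x≈-x (f (y - 1#))))) x ⟩
    Δ^ M (λ y → f y + - 1# * f (y - 1#)) x          ≈⟨ Δ^-+ M f _ x ⟩
    Δ^ M f x + Δ^ M (λ y → - 1# * f (y - 1#)) x     ≈⟨ +-congˡ (Δ^-*ˡ M (- 1#) (λ y → f (y - 1#)) x) ⟩
    Δ^ M f x + - 1# * Δ^ M (λ y → f (y - 1#)) x     ≈⟨ +-cong (df x) (*-congˡ (trans (Δ^-shift M f x) (df (x - 1#)))) ⟩
    0# + - 1# * 0#                                  ≈⟨ trans (+-identityˡ _) (zeroʳ _) ⟩
    0#                                              ∎

  DegreeBelow-≤ : ∀ {a b f} → a ℕ.≤ b → DegreeBelow a f → DegreeBelow b f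
  DegreeBelow-≤ {a} {f = f} a≤b df = go (ℕ.≤⇒≤′ a≤b)
    where
    go : ∀ {b} → a ℕ.≤′ b → DegreeBelow b f
    go ℕ.≤′-refl                = df
    go {suc b} (ℕ.≤′-step a≤′b) = DegreeBelow-suc {b} (go a≤′b)

  DegreeBelow-const : ∀ a → DegreeBelow 1 (λ _ → a)
  DegreeBelow-const a x = -‿inverseʳ a

  Δ-linear* : ∀ a (f : Carrier → Carrier) y → Δ (λ z → (z + a) * f z) y ≈ (y + a) * Δ f y + f (y - 1#)
  Δ-linear* a f y = trans
    (solve 5 (λ y a u v o → (y :+ a) :* u :- ((y :- o) :+ a) :* v := (y :+ a) :* (u :- v) :+ o :* v) refl y a (f y) (f (y - 1#)) 1#)
    (+-congˡ (*-identityˡ _))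

  DegreeBelow-linear* : ∀ M {f} a → DegreeBelow M f → DegreeBelow (suc M) (λ y → (y + a) * f y)
  DegreeBelow-linear* zero    {f} a f≈0 x = begin
    (x + a) * f x - ((x - 1#) + a) * f (x - 1#)  ≈⟨ +-cong (*-congˡ (f≈0 x)) (-‿cong (*-congˡ (f≈0 (x - 1#)))) ⟩
    (x + a) * 0# - ((x - 1#) + a) * 0#           ≈⟨ +-cong (zeroʳ _) (trans (-‿cong (zeroʳ _)) -0#≈0#) ⟩
    0# + 0#                                      ≈⟨ +-identityˡ 0# ⟩
    0#                                           ∎
  DegreeBelow-linear* (suc M) {f} a df x = begin
    Δ^ (suc M) (Δ (λ y → (y + a) * f y)) x                              ≈⟨ Δ^-cong (suc M) (Δ-linear* a f) x ⟩
    Δ^ (suc M) (λ y → (y + a) * Δ f y + f (y - 1#)) x                   ≈⟨ Δ^-+ (suc M) _ _ x ⟩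
    Δ^ (suc M) (λ y → (y + a) * Δ f y) x + Δ^ (suc M) (λ y → f (y - 1#)) x ≈⟨ +-cong (DegreeBelow-linear* M a df x) (trans (Δ^-shift (suc M) f x) (df (x - 1#))) ⟩
    0# + 0#                                                             ≈⟨ +-identityˡ 0# ⟩
    0#                                                                  ∎

  DegreeBelow-^ : ∀ δ p → DegreeBelow (suc p) (λ y → (y + δ) ^ p)
  DegreeBelow-^ δ zero    = DegreeBelow-const 1#
  DegreeBelow-^ δ (suc p) = DegreeBelow-linear* (suc p) δ (DegreeBelow-^ δ p)

  DegreeBelow-prodTo* : ∀ m (a : ℕ → Carrier) {M g} → DegreeBelow M g →
                        DegreeBelow (m ℕ.+ M) (λ y → prodTo m (λ i → y + a i) * g y)
  DegreeBelow-prodTo* zero    a {M} {g} dg = DegreeBelow-cong {M} (λ y → sym (*-identityˡ (g y))) dg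
  DegreeBelow-prodTo* (suc m) a {M} {g} dg = DegreeBelow-cong {suc (m ℕ.+ M)} (λ y → sym (*-assoc _ _ _))
    (DegreeBelow-linear* (m ℕ.+ M) (a 0) (DegreeBelow-prodTo* m (a ∘ suc) dg))

  Δ-preserves-≈ : ∀ {f} → f Preserves _≈_ ⟶ _≈_ → Δ f Preserves _≈_ ⟶ _≈_
  Δ-preserves-≈ f-cong x≈y = +-cong (f-cong x≈y) (-‿cong (f-cong (+-congʳ x≈y)))

  Δ^-binomial : ∀ M {f} → f Preserves _≈_ ⟶ _≈_ →
                ∀ x → Δ^ M f x ≈ sumTo (suc M) (λ j → sign j * ι (M C j) * f (x - ι j))
  Δ^-binomial zero {f} f-cong x = begin
    f x                      ≈⟨ f-cong (trans (sym (+-identityʳ x)) (+-congˡ (sym -0#≈0#))) ⟩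
    f (x - 0#)               ≈⟨ trans (*-congʳ (*-identityˡ 1#)) (*-identityˡ _) ⟨
    1# * 1# * f (x - 0#)     ≈⟨ *-congʳ (*-congˡ ι-1) ⟨
    1# * ι 1 * f (x - 0#)    ≈⟨ +-identityˡ _ ⟨
    0# + 1# * ι 1 * f (x - 0#) ∎
  Δ^-binomial (suc M) {f} f-cong x = begin
    Δ^ M (Δ f) x                                                ≈⟨ Δ^-binomial M (Δ-preserves-≈ f-cong) x ⟩
    sumTo (suc M) (λ j → sign j * ι (M C j) * Δ f (x - ι j))    ≈⟨ sumTo-cong (suc M) (λ j _ → split j) ⟩
    sumTo (suc M) (λ j → A j + B j)                             ≈⟨ sumTo-distrib-+ (suc M) A B ⟩
    sumTo (suc M) A + sumTo (suc M) B                           ≈⟨ +-congʳ (trans (+-congˡ A[1+M]≈0) (+-identityʳ _)) ⟨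
    sumTo (suc (suc M)) A + sumTo (suc M) B                     ≈⟨ +-congʳ (sumTo-suc (suc M) A) ⟩
    (A 0 + sumTo (suc M) (A ∘ suc)) + sumTo (suc M) B           ≈⟨ +-assoc _ _ _ ⟩
    A 0 + (sumTo (suc M) (A ∘ suc) + sumTo (suc M) B)           ≈⟨ +-congˡ (sumTo-distrib-+ (suc M) (A ∘ suc) B) ⟨
    A 0 + sumTo (suc M) (λ j → A (suc j) + B j)                 ≈⟨ +-congˡ (sumTo-cong (suc M) (λ j _ → pascal j)) ⟩
    A 0 + sumTo (suc M) (T ∘ suc)                               ≈⟨ sumTo-suc (suc M) T ⟨
    sumTo (suc (suc M)) T                                       ∎
    where
    A B T : ℕ → Carrier
    A j = sign j * ι (M C j) * f (x - ι j)
    B j = sign (suc j) * ι (M C j) * f (x - ι (suc j))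
    T j = sign j * ι (suc M C j) * f (x - ι j)

    split : ∀ j → sign j * ι (M C j) * Δ f (x - ι j) ≈ A j + B j
    split j = begin
      sign j * ι (M C j) * (f (x - ι j) - f ((x - ι j) - 1#))  ≈⟨ *-congˡ (+-congˡ (-‿cong (f-cong shift))) ⟩
      sign j * ι (M C j) * (f (x - ι j) - f (x - ι (suc j)))   ≈⟨ solve 4 (λ s c a b → s :* c :* (a :- b) := s :* c :* a :+ (:- s) :* c :* b) refl _ _ _ _ ⟩
      A j + - sign j * ι (M C j) * f (x - ι (suc j))           ≈⟨ +-congˡ (*-congʳ (*-congʳ (sign-suc j))) ⟨
      A j + B j                                                ∎
      where
      shift : (x - ι j) - 1# ≈ x - ι (suc j)
      shift = solve 3 (λ x i o → (x :- i) :- o := x :- (o :+ i)) refl x (ι j) 1#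

    A[1+M]≈0 : A (suc M) ≈ 0#
    A[1+M]≈0 = begin
      sign (suc M) * ι (M C suc M) * f (x - ι (suc M)) ≡⟨ ≡.cong (λ k → sign (suc M) * ι k * f (x - ι (suc M))) (k>n⇒nCk≡0 (ℕ.n<1+n M)) ⟩
      sign (suc M) * 0# * f (x - ι (suc M))            ≈⟨ trans (*-congʳ (zeroʳ _)) (zeroˡ _) ⟩
      0#                                               ∎

    pascal : ∀ j → A (suc j) + B j ≈ T (suc j)
    pascal j = begin
      s * ι (M C suc j) * y + s * ι (M C j) * y  ≈⟨ solve 4 (λ s a b y → s :* a :* y :+ s :* b :* y := s :* (b :+ a) :* y) refl s _ _ y ⟩
      s * (ι (M C j) + ι (M C suc j)) * y        ≈⟨ *-congʳ (*-congˡ (ι-+ (M C j) (M C suc j))) ⟨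
      s * ι (M C j ℕ.+ M C suc j) * y            ≡⟨ ≡.cong (λ k → s * ι k * y) (nCk+nC[k+1]≡[n+1]C[k+1] M j) ⟩
      T (suc j)                                  ∎
      where
      s = sign (suc j)
      y = f (x - ι (suc j))

module Evaluation {c ℓ : Level} (𝔽 : CharZeroField c ℓ) where
  open CharZeroField 𝔽
  open CommutativeRing cring hiding (zero)
  open import Algebra.Properties.CommutativeMonoid.Sum +-commutativeMonoid using (sum; sum-syntax; sum-cong-≋; sum-replicate-zero)
  open import Algebra.Properties.Semiring.Sum semiring using (*-distribˡ-sum)
  open import Relation.Binary.Reasoning.Setoid setoid
  open Poly 𝔽
  open Embeddings cring
  open FiniteSumsAndProducts cring
  open FiniteDifferences cring
  open ℤ-Solver using (solve; _:+_; _:-_; _:*_; :-_; _:=_)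
  open import Algebra.Properties.CommutativeSemigroup *-commutativeSemigroup using (x∙yz≈y∙xz)

  evalP : Pol → Carrier → Carrier
  evalP []       y = 0#
  evalP (a ∷ as) y = a + y * evalP as y

  evalP-cong : ∀ p → evalP p Preserves _≈_ ⟶ _≈_
  evalP-cong []      x≈y = refl
  evalP-cong (a ∷ p) x≈y = +-congˡ (*-cong x≈y (evalP-cong p x≈y))

  evalP-+P : ∀ p q y → evalP (p +P q) y ≈ evalP p y + evalP q y
  evalP-+P []       q        y = sym (+-identityˡ _)
  evalP-+P (a ∷ as) []       y = sym (+-identityʳ _)
  evalP-+P (a ∷ as) (b ∷ bs) y = trans (+-congˡ (*-congˡ (evalP-+P as bs y)))
    (solve 5 (λ a b y u v → (a :+ b) :+ y :* (u :+ v) := (a :+ y :* u) :+ (b :+ y :* v)) refl a b y (evalP as y) (evalP bs y))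

  evalP-scale : ∀ a p y → evalP (scale a p) y ≈ a * evalP p y
  evalP-scale a []       y = sym (zeroʳ a)
  evalP-scale a (b ∷ bs) y = trans (+-congˡ (*-congˡ (evalP-scale a bs y)))
    (solve 4 (λ a b y u → a :* b :+ y :* (a :* u) := a :* (b :+ y :* u)) refl a b y (evalP bs y))

  evalP-*P : ∀ p q y → evalP (p *P q) y ≈ evalP p y * evalP q y
  evalP-*P []       q y = sym (zeroˡ _)
  evalP-*P (a ∷ as) q y = begin
    evalP (scale a q +P (0# ∷ (as *P q))) y          ≈⟨ evalP-+P (scale a q) (0# ∷ (as *P q)) y ⟩
    evalP (scale a q) y + (0# + y * evalP (as *P q) y) ≈⟨ +-cong (evalP-scale a q y) (+-congˡ (*-congˡ (evalP-*P as q y))) ⟩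
    a * evalP q y + (0# + y * (evalP as y * evalP q y)) ≈⟨ +-congˡ (+-identityˡ _) ⟩
    a * evalP q y + y * (evalP as y * evalP q y)        ≈⟨ solve 4 (λ a u y v → a :* u :+ y :* (v :* u) := (a :+ y :* v) :* u) refl a (evalP q y) y (evalP as y) ⟩
    (a + y * evalP as y) * evalP q y                    ∎

  evalP-constP : ∀ a y → evalP (constP a) y ≈ a
  evalP-constP a y = trans (+-congˡ (zeroʳ y)) (+-identityʳ a)

  evalP-xPlus : ∀ a y → evalP (xPlus a) y ≈ y + a
  evalP-xPlus a y = trans (+-congˡ (*-congˡ (evalP-constP 1# y))) (trans (+-congˡ (*-identityʳ y)) (+-comm a y))

  evalP-compose : ∀ p q y → evalP (compose p q) y ≈ evalP p (evalP q y)
  evalP-compose []       q y = refl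
  evalP-compose (a ∷ as) q y = begin
    evalP (constP a +P (q *P compose as q)) y           ≈⟨ evalP-+P (constP a) (q *P compose as q) y ⟩
    evalP (constP a) y + evalP (q *P compose as q) y    ≈⟨ +-cong (evalP-constP a y) (evalP-*P q (compose as q) y) ⟩
    a + evalP q y * evalP (compose as q) y              ≈⟨ +-congˡ (*-congˡ (evalP-compose as q y)) ⟩
    a + evalP q y * evalP as (evalP q y)                ∎

  linearProduct : ℕ → (ℕ → Carrier) → (ℕ → ℕ) → Pol
  linearProduct N φ h = prodP (map (λ i → xPlus (φ i)) (applyUpTo h N))

  evalP-linearProduct : ∀ N φ h y → evalP (linearProduct N φ h) y ≈ prodTo N (λ i → y + φ (h i))
  evalP-linearProduct zero    φ h y = evalP-constP 1# y
  evalP-linearProduct (suc N) φ h y = trans (evalP-*P (xPlus (φ (h 0))) (linearProduct N φ (h ∘ suc)) y)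
    (*-cong (evalP-xPlus (φ (h 0)) y) (evalP-linearProduct N φ (h ∘ suc) y))

  SupportedBelow : ℕ → Pol → Set ℓ
  SupportedBelow M p = ∀ i → M ℕ.≤ i → coeff p i ≈ 0#

  coeff-+P : ∀ p q i → coeff (p +P q) i ≈ coeff p i + coeff q i
  coeff-+P []       q        i       = sym (+-identityˡ _)
  coeff-+P (a ∷ as) []       i       = sym (+-identityʳ _)
  coeff-+P (a ∷ as) (b ∷ bs) zero    = refl
  coeff-+P (a ∷ as) (b ∷ bs) (suc i) = coeff-+P as bs i

  coeff-scale : ∀ a p i → coeff (scale a p) i ≈ a * coeff p i
  coeff-scale a []       i       = sym (zeroʳ a)
  coeff-scale a (b ∷ bs) zero    = refl
  coeff-scale a (b ∷ bs) (suc i) = coeff-scale a bs i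

  SupportedBelow-≤ : ∀ {a b} p → a ℕ.≤ b → SupportedBelow a p → SupportedBelow b p
  SupportedBelow-≤ p a≤b sp i b≤i = sp i (ℕ.≤-trans a≤b b≤i)

  SupportedBelow-+P : ∀ {M} p q → SupportedBelow M p → SupportedBelow M q → SupportedBelow M (p +P q)
  SupportedBelow-+P p q sp sq i M≤i = trans (coeff-+P p q i) (trans (+-cong (sp i M≤i) (sq i M≤i)) (+-identityˡ 0#))

  SupportedBelow-scale : ∀ {M} a p → SupportedBelow M p → SupportedBelow M (scale a p)
  SupportedBelow-scale a p sp i M≤i = trans (coeff-scale a p i) (trans (*-congˡ (sp i M≤i)) (zeroʳ a))

  SupportedBelow-∷ : ∀ {M} a p → SupportedBelow M p → SupportedBelow (suc M) (a ∷ p)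
  SupportedBelow-∷ a p sp (suc i) (ℕ.s≤s M≤i) = sp i M≤i

  SupportedBelow-tail : ∀ {M} a p → SupportedBelow (suc M) (a ∷ p) → SupportedBelow M p
  SupportedBelow-tail a p sp i M≤i = sp (suc i) (ℕ.s≤s M≤i)

  SupportedBelow0-tail : ∀ a p → SupportedBelow 0 (a ∷ p) → SupportedBelow 0 p
  SupportedBelow0-tail a p sp i _ = sp (suc i) ℕ.z≤n

  SupportedBelow-length : ∀ p → SupportedBelow (length p) p
  SupportedBelow-length []      i _ = refl
  SupportedBelow-length (a ∷ p)     = SupportedBelow-∷ a p (SupportedBelow-length p)

  SupportedBelow0-∷ : ∀ {a} p → a ≈ 0# → SupportedBelow 0 p → SupportedBelow 0 (a ∷ p)
  SupportedBelow0-∷ p a≈0 sp zero    _ = a≈0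
  SupportedBelow0-∷ p a≈0 sp (suc i) _ = sp i ℕ.z≤n

  SupportedBelow0-*Pˡ : ∀ p q → SupportedBelow 0 p → SupportedBelow 0 (p *P q)
  SupportedBelow0-*Pˡ []       q sp i _ = refl
  SupportedBelow0-*Pˡ (a ∷ as) q sp = SupportedBelow-+P (scale a q) (0# ∷ (as *P q)) scaled
    (SupportedBelow0-∷ (as *P q) refl (SupportedBelow0-*Pˡ as q (SupportedBelow0-tail a as sp)))
    where
    scaled : SupportedBelow 0 (scale a q)
    scaled i _ = trans (coeff-scale a q i) (trans (*-congʳ (sp 0 ℕ.z≤n)) (zeroˡ _))

  SupportedBelow0-*Pʳ : ∀ p q → SupportedBelow 0 q → SupportedBelow 0 (p *P q)
  SupportedBelow0-*Pʳ []       q sq i _ = refl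
  SupportedBelow0-*Pʳ (a ∷ as) q sq = SupportedBelow-+P (scale a q) (0# ∷ (as *P q)) (SupportedBelow-scale a q sq)
    (SupportedBelow0-∷ (as *P q) refl (SupportedBelow0-*Pʳ as q sq))

  SupportedBelow-*P : ∀ a b p q → SupportedBelow (suc a) p → SupportedBelow (suc b) q →
                      SupportedBelow (suc (a ℕ.+ b)) (p *P q)
  SupportedBelow-*P a b []       q sp sq i _ = refl
  SupportedBelow-*P a b (x ∷ xs) q sp sq = SupportedBelow-+P (scale x q) (0# ∷ (xs *P q))
    (SupportedBelow-≤ (scale x q) (ℕ.s≤s (ℕ.m≤n+m b a)) (SupportedBelow-scale x q sq))
    (SupportedBelow-∷ 0# (xs *P q) (rest a (SupportedBelow-tail x xs sp)))
    where
    rest : ∀ a → SupportedBelow a xs → SupportedBelow (a ℕ.+ b) (xs *P q)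
    rest zero     sxs = SupportedBelow-≤ (xs *P q) ℕ.z≤n (SupportedBelow0-*Pˡ xs q sxs)
    rest (suc a′) sxs = SupportedBelow-*P a′ b xs q sxs sq

  SupportedBelow0-compose : ∀ p q → SupportedBelow 0 p → SupportedBelow 0 (compose p q)
  SupportedBelow0-compose []       q sp i _ = refl
  SupportedBelow0-compose (a ∷ as) q sp = SupportedBelow-+P (constP a) (q *P compose as q)
    (SupportedBelow0-∷ [] (sp 0 ℕ.z≤n) (λ i _ → refl))
    (SupportedBelow0-*Pʳ q (compose as q) (SupportedBelow0-compose as q (SupportedBelow0-tail a as sp)))

  SupportedBelow-compose-xPlus : ∀ m p γ → SupportedBelow (suc m) p → SupportedBelow (suc m) (compose p (xPlus γ))
  SupportedBelow-compose-xPlus m       []       γ sp i _ = refl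
  SupportedBelow-compose-xPlus zero    (a ∷ as) γ sp = SupportedBelow-+P (constP a) (xPlus γ *P compose as (xPlus γ))
    (SupportedBelow-length (constP a))
    (SupportedBelow-≤ (xPlus γ *P compose as (xPlus γ)) ℕ.z≤n
      (SupportedBelow0-*Pʳ (xPlus γ) (compose as (xPlus γ)) (SupportedBelow0-compose as (xPlus γ) (SupportedBelow-tail a as sp))))
  SupportedBelow-compose-xPlus (suc m) (a ∷ as) γ sp = SupportedBelow-+P (constP a) (xPlus γ *P compose as (xPlus γ))
    (SupportedBelow-≤ (constP a) (ℕ.s≤s ℕ.z≤n) (SupportedBelow-length (constP a)))
    (SupportedBelow-*P 1 m (xPlus γ) (compose as (xPlus γ)) (SupportedBelow-length (xPlus γ))
      (SupportedBelow-compose-xPlus m as γ (SupportedBelow-tail a as sp)))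

  SupportedBelow-linearProduct : ∀ N φ h → SupportedBelow (suc N) (linearProduct N φ h)
  SupportedBelow-linearProduct zero    φ h = SupportedBelow-length (constP 1#)
  SupportedBelow-linearProduct (suc N) φ h = SupportedBelow-*P 1 N (xPlus (φ (h 0))) (linearProduct N φ (h ∘ suc))
    (SupportedBelow-length (xPlus _)) (SupportedBelow-linearProduct N φ (h ∘ suc))

  sumF≡sum : ∀ {m} (f : Fin m → Carrier) → sumF f ≡ sum f
  sumF≡sum {zero}  f = ≡.refl
  sumF≡sum {suc m} f = ≡.cong (_+_ (f Fin.zero)) (sumF≡sum (f ∘ Fin.suc))

  sum-zero : ∀ {m} {f : Fin m → Carrier} → (∀ i → f i ≈ 0#) → sum f ≈ 0#
  sum-zero {m} f≈0 = trans (sum-cong-≋ f≈0) (sum-replicate-zero m)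

  evalP-SupportedBelow0 : ∀ p y → SupportedBelow 0 p → evalP p y ≈ 0#
  evalP-SupportedBelow0 []       y sp = refl
  evalP-SupportedBelow0 (a ∷ as) y sp = begin
    a + y * evalP as y  ≈⟨ +-cong (sp 0 ℕ.z≤n) (*-congˡ (evalP-SupportedBelow0 as y (SupportedBelow0-tail a as sp))) ⟩
    0# + y * 0#         ≈⟨ trans (+-identityˡ _) (zeroʳ y) ⟩
    0#                  ∎

  evalP-truncate : ∀ M p y → SupportedBelow M p → evalP p y ≈ ∑[ i < M ] (coeff p (Fin.toℕ i) * y ^ Fin.toℕ i)
  evalP-truncate zero    p        y sp = evalP-SupportedBelow0 p y sp
  evalP-truncate (suc M) []       y sp = sym (sum-zero {suc M} (λ i → zeroˡ (y ^ Fin.toℕ i)))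
  evalP-truncate (suc M) (a ∷ as) y sp = begin
    a + y * evalP as y                                                ≈⟨ +-cong (sym (*-identityʳ a)) (*-congˡ (evalP-truncate M as y (SupportedBelow-tail a as sp))) ⟩
    a * 1# + y * ∑[ i < M ] (coeff as (Fin.toℕ i) * y ^ Fin.toℕ i)    ≈⟨ +-congˡ (*-distribˡ-sum {M} y (λ i → coeff as (Fin.toℕ i) * y ^ Fin.toℕ i)) ⟩
    a * 1# + ∑[ i < M ] (y * (coeff as (Fin.toℕ i) * y ^ Fin.toℕ i))  ≈⟨ +-congˡ (sum-cong-≋ {M} (λ i → x∙yz≈y∙xz y _ _)) ⟩
    a * 1# + ∑[ i < M ] (coeff as (Fin.toℕ i) * (y * y ^ Fin.toℕ i))  ∎

  eval : ∀ {m} → (Fin m → Carrier) → Carrier → Carrier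
  eval c y = sum (λ i → c i * y ^ Fin.toℕ i)

  eval-cong : ∀ {m} (c : Fin m → Carrier) → eval c Preserves _≈_ ⟶ _≈_
  eval-cong {m} c x≈y = sum-cong-≋ {m} (λ i → *-congˡ (^-congˡ (Fin.toℕ i) x≈y))

  coeff-tabulate : ∀ {m} (c : Fin m → Carrier) i → coeff (tabulate c) (Fin.toℕ i) ≡ c i
  coeff-tabulate c Fin.zero    = ≡.refl
  coeff-tabulate c (Fin.suc i) = coeff-tabulate (c ∘ Fin.suc) i

  SupportedBelow-tabulate : ∀ {m} (c : Fin m → Carrier) → SupportedBelow m (tabulate c)
  SupportedBelow-tabulate c = ≡.subst (λ k → SupportedBelow k (tabulate c)) (List.length-tabulate c) (SupportedBelow-length (tabulate c))

  eval≈evalP-tabulate : ∀ {m} (c : Fin m → Carrier) y → eval c y ≈ evalP (tabulate c) y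
  eval≈evalP-tabulate {m} c y = sym (trans (evalP-truncate m (tabulate c) y (SupportedBelow-tabulate c))
    (sum-cong-≋ {m} (λ i → *-congʳ (reflexive (coeff-tabulate c i)))))

  DegreeBelow-eval-shift : ∀ {n} (c : P≤ n) δ → DegreeBelow (suc n) (λ y → eval c (y + δ))
  DegreeBelow-eval-shift {n} c δ = DegreeBelow-sum {suc n} (λ p y → c p * (y + δ) ^ Fin.toℕ p)
    (λ p → DegreeBelow-*ˡ {suc n} (c p) (DegreeBelow-≤ (ℕ.s≤s (Fin.toℕ≤pred[n] p)) (DegreeBelow-^ δ (Fin.toℕ p))))

  eval-E : ∀ {n} γ (c : P≤ n) y → eval (E γ c) y ≈ eval c (y + γ)
  eval-E {n} γ c y = begin
    eval (E γ c) y                              ≈⟨ evalP-truncate (suc n) (compose (tabulate c) (xPlus γ)) y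
                                                     (SupportedBelow-compose-xPlus n (tabulate c) γ (SupportedBelow-tabulate c)) ⟨
    evalP (compose (tabulate c) (xPlus γ)) y    ≈⟨ evalP-compose (tabulate c) (xPlus γ) y ⟩
    evalP (tabulate c) (evalP (xPlus γ) y)      ≈⟨ evalP-cong (tabulate c) (evalP-xPlus γ y) ⟩
    evalP (tabulate c) (y + γ)                  ≈⟨ eval≈evalP-tabulate c (y + γ) ⟨
    eval c (y + γ)                              ∎

module Reflection {c ℓ : Level} (𝔽 : CharZeroField c ℓ) where
  open CharZeroField 𝔽
  open CommutativeRing cring hiding (zero)
  open import Algebra.Properties.CommutativeMonoid.Sum +-commutativeMonoid using (sum; sum-syntax; sum-cong-≋; ∑-comm; sum-permute)
  open import Algebra.Properties.Semiring.Sum semiring using (*-distribˡ-sum; *-distribʳ-sum)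
  open import Relation.Binary.Reasoning.Setoid setoid
  open Poly 𝔽
  open Embeddings cring
  open FiniteSumsAndProducts cring
  open FiniteDifferences cring
  open Evaluation 𝔽
  open ℤ-Solver using (solve; _:+_; _:-_; _:*_; :-_; _:=_)
  open import Algebra.Properties.Ring ring using (-1*x≈-x)
  open import Algebra.Properties.CommutativeSemigroup *-commutativeSemigroup using (x∙yz≈y∙xz)

  ι-^ : ∀ m p → ι (m ℕ.^ p) ≈ ι m ^ p
  ι-^ m zero    = ι-1
  ι-^ m (suc p) = trans (ι-* m (m ℕ.^ p)) (*-congˡ (ι-^ m p))

  ιℤ-sumℤ : ∀ k f → ιℤ (sumℤ k f) ≈ sumTo (suc k) (λ j → ιℤ (f j))
  ιℤ-sumℤ zero    f = sym (+-identityˡ _)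
  ιℤ-sumℤ (suc k) f = trans (ιℤ-+ (sumℤ k f) (f (suc k))) (+-congʳ (ιℤ-sumℤ k f))

  Fcoeff-summand : ∀ n p K → ∃ λ f → Fcoeff n p K ≡ sumℤ K f
  Fcoeff-summand n p K = _ , ≡.refl

  Fcoeff-weight : ℕ → ℕ → ℕ → ℕ → ℕ
  Fcoeff-weight n p K j = (suc (2 ℕ.* n) C j) ℕ.* ((K ∸ j) ℕ.^ p) ℕ.* ((K ∸ j ℕ.+ n) C n)

  -- The sign of the j-th summand of Fcoeff is a where-function of Defs and cannot be named,
  -- so the motive of the parity induction is a metavariable, solved from the goal below.
  mutual
    FcoeffSignMotive : ℕ → ℕ → ℕ → ℕ → ℕ → Set ℓ
    FcoeffSignMotive = _

    ιℤ-Fcoeff-summand : ∀ n p K j → ιℤ (proj₁ (Fcoeff-summand n p K) j) ≈ sign j * ι (Fcoeff-weight n p K j)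
    ιℤ-Fcoeff-summand n p K j with Fcoeff-weight n p K j
    ... | m = parity-induction (λ j → ∀ m → FcoeffSignMotive n p K j m) even odd
                (λ j hyp m → trans (hyp m) (*-congʳ (sym (sign-suc-suc j)))) j m
      where
      even : ∀ m → ιℤ (+ 1 ℤ.* + m) ≈ sign 0 * ι m
      even m = trans (reflexive (≡.cong ιℤ (ℤ.*-identityˡ (+ m)))) (sym (*-identityˡ (ι m)))
      odd : ∀ m → ιℤ (ℤ.- (+ 1) ℤ.* + m) ≈ sign 1 * ι m
      odd m = begin
        ιℤ (ℤ.- (+ 1) ℤ.* + m)  ≡⟨ ≡.cong ιℤ (ℤ.-1*i≡-i (+ m)) ⟩
        ιℤ (ℤ.- (+ m))          ≈⟨ ιℤ-neg (+ m) ⟩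
        - ι m                   ≈⟨ -1*x≈-x (ι m) ⟨
        - 1# * ι m              ≈⟨ *-congʳ (*-identityʳ (- 1#)) ⟨
        sign 1 * ι m            ∎

  ιℤ-Fcoeff : ∀ n p K → ιℤ (Fcoeff n p K) ≈ sumTo (suc K) (λ j → sign j * ι (Fcoeff-weight n p K j))
  ιℤ-Fcoeff n p K = trans (ιℤ-sumℤ K (proj₁ (Fcoeff-summand n p K))) (sumTo-cong (suc K) (λ j _ → ιℤ-Fcoeff-summand n p K j))

  Fsum : ℕ → (Carrier → Carrier) → ℕ → Carrier
  Fsum n G K = sumTo (suc K) (λ j → sign j * ι (suc (2 ℕ.* n) C j) * ι ((K ∸ j ℕ.+ n) C n) * G (ι (K ∸ j)))

  F≈Fsum : ∀ n (c : P≤ n) k → F n c k ≈ Fsum n (eval c) (Fin.toℕ k)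
  F≈Fsum n c k = begin
    F n c k                                                       ≡⟨ sumF≡sum (λ p → c p * ιℤ (Fcoeff n (Fin.toℕ p) K)) ⟩
    ∑[ p < suc n ] (c p * ιℤ (Fcoeff n (Fin.toℕ p) K))           ≈⟨ sum-cong-≋ {suc n} (λ p → *-congˡ {c p} (ιℤ-Fcoeff n (Fin.toℕ p) K)) ⟩
    ∑[ p < suc n ] (c p * sumTo (suc K) (t p))                    ≈⟨ sum-cong-≋ {suc n} (λ p → *-distribˡ-sumTo (suc K) (c p) (t p)) ⟩
    ∑[ p < suc n ] sumTo (suc K) (λ j → c p * t p j)              ≈⟨ ∑-sumTo-comm (suc K) (λ p j → c p * t p j) ⟩
    sumTo (suc K) (λ j → ∑[ p < suc n ] (c p * t p j))            ≈⟨ sumTo-cong (suc K) (λ j _ → factor j) ⟩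
    Fsum n (eval c) K                                             ∎
    where
    K = Fin.toℕ k
    t : Fin (suc n) → ℕ → Carrier
    t p j = sign j * ι (Fcoeff-weight n (Fin.toℕ p) K j)

    factor : ∀ j → ∑[ p < suc n ] (c p * t p j) ≈ sign j * ι (suc (2 ℕ.* n) C j) * ι ((K ∸ j ℕ.+ n) C n) * eval c (ι (K ∸ j))
    factor j = trans (sum-cong-≋ {suc n} rearrange) (sym (*-distribˡ-sum (sign j * a * b) (λ p → c p * ι (K ∸ j) ^ Fin.toℕ p)))
      where
      a = ι (suc (2 ℕ.* n) C j)
      b = ι ((K ∸ j ℕ.+ n) C n)
      ι-weight : ∀ p → ι (Fcoeff-weight n p K j) ≈ a * ι (K ∸ j) ^ p * b
      ι-weight p = begin
        ι ((suc (2 ℕ.* n) C j) ℕ.* (K ∸ j) ℕ.^ p ℕ.* ((K ∸ j ℕ.+ n) C n)) ≈⟨ ι-* ((suc (2 ℕ.* n) C j) ℕ.* (K ∸ j) ℕ.^ p) ((K ∸ j ℕ.+ n) C n) ⟩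
        ι ((suc (2 ℕ.* n) C j) ℕ.* (K ∸ j) ℕ.^ p) * b                 ≈⟨ *-congʳ (ι-* (suc (2 ℕ.* n) C j) ((K ∸ j) ℕ.^ p)) ⟩
        a * ι ((K ∸ j) ℕ.^ p) * b                                     ≈⟨ *-congʳ (*-congˡ (ι-^ (K ∸ j) p)) ⟩
        a * ι (K ∸ j) ^ p * b                                         ∎
      rearrange : ∀ p → c p * t p j ≈ sign j * a * b * (c p * ι (K ∸ j) ^ Fin.toℕ p)
      rearrange p = begin
        c p * (sign j * ι (Fcoeff-weight n (Fin.toℕ p) K j))  ≈⟨ *-congˡ (*-congˡ (ι-weight (Fin.toℕ p))) ⟩
        c p * (sign j * (a * ι (K ∸ j) ^ Fin.toℕ p * b))      ≈⟨ solve 5 (λ x s a w b → x :* (s :* (a :* w :* b)) := s :* a :* b :* (x :* w)) refl (c p) (sign j) a (ι (K ∸ j) ^ Fin.toℕ p) b ⟩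
        sign j * a * b * (c p * ι (K ∸ j) ^ Fin.toℕ p)        ∎

  evalP-FinvBasis : ∀ n p y → evalP (FinvBasis n p) y ≈
    ratio n * (prodTo p (λ i → y + - ι i) * prodTo (n ∸ p) (λ i → y + (ι (suc n) + ι i)))
  evalP-FinvBasis n p y = trans (evalP-scale (ratio n) (falling p *P rising (ι (suc n)) (n ∸ p)) y)
    (*-congˡ (trans (evalP-*P (falling p) (rising (ι (suc n)) (n ∸ p)) y)
      (*-cong (evalP-linearProduct p (λ i → - ι i) (λ i → i) y) (evalP-linearProduct (n ∸ p) (λ i → ι (suc n) + ι i) (λ i → i) y))))

  SupportedBelow-FinvBasis : ∀ n p → p ℕ.≤ n → SupportedBelow (suc n) (FinvBasis n p)
  SupportedBelow-FinvBasis n p p≤n = ≡.subst (λ m → SupportedBelow (suc m) (FinvBasis n p)) (ℕ.m+[n∸m]≡n p≤n)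
    (SupportedBelow-scale (ratio n) (falling p *P rising (ι (suc n)) (n ∸ p))
      (SupportedBelow-*P p (n ∸ p) (falling p) (rising (ι (suc n)) (n ∸ p))
        (SupportedBelow-linearProduct p (λ i → - ι i) (λ i → i))
        (SupportedBelow-linearProduct (n ∸ p) (λ i → ι (suc n) + ι i) (λ i → i))))

  eval-Finv : ∀ n (c : P≤ n) y → eval (Finv n c) y ≈ ∑[ p < suc n ] (c p * evalP (FinvBasis n (Fin.toℕ p)) y)
  eval-Finv n c y = begin
    ∑[ k < suc n ] (Finv n c k * y ^ Fin.toℕ k)                    ≈⟨ sum-cong-≋ {suc n} (λ k → *-congʳ {y ^ Fin.toℕ k} (reflexive (sumF≡sum (λ p → c p * B p k)))) ⟩
    ∑[ k < suc n ] (∑[ p < suc n ] (c p * B p k) * y ^ Fin.toℕ k)  ≈⟨ sum-cong-≋ {suc n} (λ k → *-distribʳ-sum (y ^ Fin.toℕ k) (λ p → c p * B p k)) ⟩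
    ∑[ k < suc n ] ∑[ p < suc n ] (c p * B p k * y ^ Fin.toℕ k)    ≈⟨ ∑-comm (λ k p → c p * B p k * y ^ Fin.toℕ k) ⟩
    ∑[ p < suc n ] ∑[ k < suc n ] (c p * B p k * y ^ Fin.toℕ k)    ≈⟨ sum-cong-≋ {suc n} (λ p → trans (sum-cong-≋ {suc n} (λ k → *-assoc (c p) (B p k) (y ^ Fin.toℕ k))) (sym (*-distribˡ-sum {suc n} (c p) (λ k → B p k * y ^ Fin.toℕ k)))) ⟩
    ∑[ p < suc n ] (c p * ∑[ k < suc n ] (B p k * y ^ Fin.toℕ k))  ≈⟨ sum-cong-≋ {suc n} (λ p → *-congˡ {c p} (sym (evalP-truncate (suc n) (FinvBasis n (Fin.toℕ p)) y (SupportedBelow-FinvBasis n (Fin.toℕ p) (Fin.toℕ≤pred[n] p))))) ⟩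
    ∑[ p < suc n ] (c p * evalP (FinvBasis n (Fin.toℕ p)) y)        ∎
    where
    B : Fin (suc n) → Fin (suc n) → Carrier
    B p k = coeff (FinvBasis n (Fin.toℕ p)) (Fin.toℕ k)

  FinvBasis-reflect : ∀ n q z → q ℕ.≤ n →
    evalP (FinvBasis n (n ∸ q)) z ≈ sign n * evalP (FinvBasis n q) (- z - ι (suc n))
  FinvBasis-reflect n q z q≤n = begin
    evalP (FinvBasis n (n ∸ q)) z                             ≈⟨ evalP-FinvBasis n (n ∸ q) z ⟩
    ratio n * (P₂ * prodTo (n ∸ (n ∸ q)) (λ i → z + (ι (suc n) + ι i))) ≡⟨ ≡.cong (λ m → ratio n * (P₂ * prodTo m (λ i → z + (ι (suc n) + ι i)))) (ℕ.m∸[m∸n]≡n q≤n) ⟩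
    ratio n * (P₂ * P₁)                                       ≈⟨ *-identityˡ _ ⟨
    1# * (ratio n * (P₂ * P₁))                                ≈⟨ *-congʳ (trans (*-cong (sign-square q) (sign-square (n ∸ q))) (*-identityˡ 1#)) ⟨
    (sign q * sign q) * (sign (n ∸ q) * sign (n ∸ q)) * (ratio n * (P₂ * P₁))
      ≈⟨ solve 5 (λ r p₂ p₁ a b → (a :* a) :* (b :* b) :* (r :* (p₂ :* p₁)) := (a :* b) :* (r :* ((a :* p₁) :* (b :* p₂)))) refl (ratio n) P₂ P₁ (sign q) (sign (n ∸ q)) ⟩
    (sign q * sign (n ∸ q)) * (ratio n * ((sign q * P₁) * (sign (n ∸ q) * P₂)))
      ≈⟨ *-cong sign-split (*-congˡ (*-cong reflect₁ reflect₂)) ⟨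
    sign n * (ratio n * (prodTo q (λ i → w + - ι i) * prodTo (n ∸ q) (λ i → w + (ι (suc n) + ι i))))
      ≈⟨ *-congˡ (evalP-FinvBasis n q w) ⟨
    sign n * evalP (FinvBasis n q) w                          ∎
    where
    w  = - z - ι (suc n)
    P₁ = prodTo q (λ i → z + (ι (suc n) + ι i))
    P₂ = prodTo (n ∸ q) (λ i → z + - ι i)
    sign-split : sign n ≈ sign q * sign (n ∸ q)
    sign-split = trans (reflexive (≡.cong sign (≡.sym (ℕ.m+[n∸m]≡n q≤n)))) (sign-+ q (n ∸ q))
    reflect₁ : prodTo q (λ i → w + - ι i) ≈ sign q * P₁
    reflect₁ = trans (prodTo-cong q (λ i _ → solve 3 (λ z a b → (:- z :- a) :+ (:- b) := :- (z :+ (a :+ b))) refl z (ι (suc n)) (ι i)))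
                     (prodTo-neg q (λ i → z + (ι (suc n) + ι i)))
    reflect₂ : prodTo (n ∸ q) (λ i → w + (ι (suc n) + ι i)) ≈ sign (n ∸ q) * P₂
    reflect₂ = trans (prodTo-cong (n ∸ q) (λ i _ → solve 3 (λ z a b → (:- z :- a) :+ (a :+ b) := :- (z :+ (:- b))) refl z (ι (suc n)) (ι i)))
                     (prodTo-neg (n ∸ q) (λ i → z + - ι i))

  eval-Finv-J : ∀ n (c : P≤ n) z → eval (Finv n (J n c)) z ≈ sign n * eval (Finv n c) (- z - ι (suc n))
  eval-Finv-J n c z = begin
    eval (Finv n (J n c)) z                                                        ≈⟨ eval-Finv n (J n c) z ⟩
    ∑[ p < suc n ] (c (Fin.opposite p) * evalP (B (Fin.toℕ p)) z)                  ≈⟨ sum-permute {suc n} (λ p → c (Fin.opposite p) * evalP (B (Fin.toℕ p)) z) Permutation.reverse ⟩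
    ∑[ p < suc n ] (c (Fin.opposite (Fin.opposite p)) * evalP (B (Fin.toℕ (Fin.opposite p))) z)
      ≈⟨ sum-cong-≋ {suc n} (λ p → *-cong (reflexive (≡.cong c (Fin.opposite-involutive p))) (reflexive (≡.cong (λ m → evalP (B m) z) (Fin.opposite-prop p)))) ⟩
    ∑[ p < suc n ] (c p * evalP (B (n ∸ Fin.toℕ p)) z)                              ≈⟨ sum-cong-≋ {suc n} (λ p → *-congˡ {c p} (FinvBasis-reflect n (Fin.toℕ p) z (Fin.toℕ≤pred[n] p))) ⟩
    ∑[ p < suc n ] (c p * (sign n * evalP (B (Fin.toℕ p)) w))                        ≈⟨ sum-cong-≋ {suc n} (λ p → x∙yz≈y∙xz (c p) (sign n) (evalP (B (Fin.toℕ p)) w)) ⟩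
    ∑[ p < suc n ] (sign n * (c p * evalP (B (Fin.toℕ p)) w))                        ≈⟨ *-distribˡ-sum (sign n) (λ p → c p * evalP (B (Fin.toℕ p)) w) ⟨
    sign n * ∑[ p < suc n ] (c p * evalP (B (Fin.toℕ p)) w)                          ≈⟨ *-congˡ (eval-Finv n c w) ⟨
    sign n * eval (Finv n c) w                                                     ∎
    where
    w = - z - ι (suc n)
    B : ℕ → Pol
    B = FinvBasis n

  shiftedRising : ℕ → Carrier → Carrier
  shiftedRising n y = prodTo n (λ i → y + ι (suc i))

  shiftedRising-ι : ∀ n m → shiftedRising n (ι m) ≈ ι (n !) * ι ((m ℕ.+ n) C n)
  shiftedRising-ι zero    m = sym (trans (*-cong ι-1 ι-1) (*-identityˡ 1#))
  shiftedRising-ι (suc n) m = begin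
    shiftedRising (suc n) (ι m)                                  ≈⟨ prodTo-last n (λ i → ι m + ι (suc i)) ⟩
    shiftedRising n (ι m) * (ι m + ι (suc n))                    ≈⟨ *-cong (shiftedRising-ι n m) (sym (ι-+ m (suc n))) ⟩
    ι (n !) * ι ((m ℕ.+ n) C n) * ι (m ℕ.+ suc n)                ≡⟨ ≡.cong (λ k → ι (n !) * ι ((m ℕ.+ n) C n) * ι k) (ℕ.+-suc m n) ⟩
    ι (n !) * ι ((m ℕ.+ n) C n) * ι (suc (m ℕ.+ n))              ≈⟨ trans (ι-* (n ! ℕ.* ((m ℕ.+ n) C n)) (suc (m ℕ.+ n))) (*-congʳ (ι-* (n !) ((m ℕ.+ n) C n))) ⟨
    ι (n ! ℕ.* ((m ℕ.+ n) C n) ℕ.* suc (m ℕ.+ n))               ≡⟨ ≡.cong ι (n!*[m+n]Cn*[1+m+n]≡[1+n]!*[m+1+n]C[1+n] m n) ⟩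
    ι (suc n ! ℕ.* ((m ℕ.+ suc n) C suc n))                      ≈⟨ ι-* (suc n !) _ ⟩
    ι (suc n !) * ι ((m ℕ.+ suc n) C suc n)                      ∎

  shiftedRising-cong : ∀ n → shiftedRising n Preserves _≈_ ⟶ _≈_
  shiftedRising-cong n x≈y = prodTo-cong n (λ i _ → +-congʳ x≈y)

  shiftedRising-root : ∀ n i → i ℕ.< n → shiftedRising n (- ι (suc i)) ≈ 0#
  shiftedRising-root n i i<n = prodTo-zero n i i<n (-‿inverseˡ (ι (suc i)))

  shiftedRising-reflect : ∀ n y → shiftedRising n (- y - ι (suc n)) ≈ sign n * shiftedRising n y
  shiftedRising-reflect n y = begin
    prodTo n (λ i → w + ι (suc i))                       ≈⟨ prodTo-reverse n (λ i → w + ι (suc i)) ⟩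
    prodTo n (λ i → w + ι (suc (n ∸ suc i)))             ≈⟨ prodTo-cong n (λ i i<n → factor i i<n) ⟩
    prodTo n (λ i → - (y + ι (suc i)))                   ≈⟨ prodTo-neg n (λ i → y + ι (suc i)) ⟩
    sign n * shiftedRising n y                           ∎
    where
    w = - y - ι (suc n)
    factor : ∀ i → i ℕ.< n → w + ι (suc (n ∸ suc i)) ≈ - (y + ι (suc i))
    factor i i<n = begin
      - y - ι (suc n) + a                  ≈⟨ +-congʳ (+-congˡ (-‿cong (trans (reflexive (≡.cong ι (≡.sym complement))) (ι-+ (suc (n ∸ suc i)) (suc i))))) ⟩
      - y - (a + ι (suc i)) + a            ≈⟨ solve 3 (λ y a b → :- y :- (a :+ b) :+ a := :- (y :+ b)) refl y a (ι (suc i)) ⟩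
      - (y + ι (suc i))                    ∎
      where
      a = ι (suc (n ∸ suc i))
      complement : suc (n ∸ suc i) ℕ.+ suc i ≡ suc n
      complement = ≡.cong suc (ℕ.m∸n+n≡m i<n)

  ι-∸ : ∀ {j K} → j ℕ.≤ K → ι K - ι j ≈ ι (K ∸ j)
  ι-∸ {j} {K} j≤K = begin
    ι K - ι j                  ≡⟨ ≡.cong (λ m → ι m - ι j) (ℕ.m+[n∸m]≡n j≤K) ⟨
    ι (j ℕ.+ (K ∸ j)) - ι j    ≈⟨ +-congʳ (ι-+ j (K ∸ j)) ⟩
    (ι j + ι (K ∸ j)) - ι j    ≈⟨ solve 2 (λ a b → (a :+ b) :- a := b) refl (ι j) (ι (K ∸ j)) ⟩
    ι (K ∸ j)                  ∎

  ι[K]-ι[1+K+x]≈-ι[1+x] : ∀ K x → ι K - ι (suc K ℕ.+ x) ≈ - ι (suc x)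
  ι[K]-ι[1+K+x]≈-ι[1+x] K x = begin
    ι K - (1# + ι (K ℕ.+ x))     ≈⟨ +-congˡ (-‿cong (+-congˡ (ι-+ K x))) ⟩
    ι K - (1# + (ι K + ι x))     ≈⟨ solve 3 (λ k x o → k :- (o :+ (k :+ x)) := :- (o :+ x)) refl (ι K) (ι x) 1# ⟩
    - (1# + ι x)                 ∎

  module FsumReflection {n K r : ℕ} (K+r≡n : K ℕ.+ r ≡ n) {G : Carrier → Carrier}
                        (G-cong : G Preserves _≈_ ⟶ _≈_) (G-degree : DegreeBelow (suc n) G) where

    M : ℕ
    M = suc (2 ℕ.* n)

    G′ : Carrier → Carrier
    G′ y = G (- y - ι (suc n))

    Q : Carrier → Carrier
    Q y = shiftedRising n y * G y

    T : ℕ → Carrier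
    T j = sign j * ι (M C j) * Q (ι K - ι j)

    Q-cong : Q Preserves _≈_ ⟶ _≈_
    Q-cong x≈y = *-cong (shiftedRising-cong n x≈y) (G-cong x≈y)

    Q-degree : DegreeBelow M Q
    Q-degree = DegreeBelow-≤ (ℕ.≤-reflexive n+[1+n]≡M) (DegreeBelow-prodTo* n (λ i → ι (suc i)) G-degree)
      where
      n+[1+n]≡M : n ℕ.+ suc n ≡ M
      n+[1+n]≡M = ≡.trans (ℕ.+-suc n n) (≡.cong (λ m → suc (n ℕ.+ m)) (≡.sym (ℕ.+-identityʳ n)))

    ∑T≈0 : sumTo (suc M) T ≈ 0#
    ∑T≈0 = trans (sym (Δ^-binomial M Q-cong (ι K))) (Q-degree (ι K))

    low : sumTo (suc K) T ≈ ι (n !) * Fsum n G K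
    low = trans (sumTo-cong (suc K) (λ j j<1+K → term j (ℕ.<⇒≤pred j<1+K)))
                (sym (*-distribˡ-sumTo (suc K) (ι (n !)) _))
      where
      term : ∀ j → j ℕ.≤ K → T j ≈ ι (n !) * (sign j * ι (M C j) * ι ((K ∸ j ℕ.+ n) C n) * G (ι (K ∸ j)))
      term j j≤K = begin
        sign j * ι (M C j) * (shiftedRising n (ι K - ι j) * G (ι K - ι j))    ≈⟨ *-congˡ (Q-cong (ι-∸ j≤K)) ⟩
        sign j * ι (M C j) * (shiftedRising n (ι (K ∸ j)) * G (ι (K ∸ j)))    ≈⟨ *-congˡ (*-congʳ (shiftedRising-ι n (K ∸ j))) ⟩
        sign j * ι (M C j) * (ι (n !) * ι ((K ∸ j ℕ.+ n) C n) * G (ι (K ∸ j)))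
          ≈⟨ solve 5 (λ s c f b g → s :* c :* (f :* b :* g) := f :* (s :* c :* b :* g)) refl (sign j) (ι (M C j)) (ι (n !)) _ _ ⟩
        ι (n !) * (sign j * ι (M C j) * ι ((K ∸ j ℕ.+ n) C n) * G (ι (K ∸ j))) ∎

    middle : sumTo n (λ i → T (suc K ℕ.+ i)) ≈ 0#
    middle = sumTo-zero n (λ i i<n → begin
      sign (suc K ℕ.+ i) * ι (M C (suc K ℕ.+ i)) * Q (ι K - ι (suc K ℕ.+ i))  ≈⟨ *-congˡ (Q-cong (ι[K]-ι[1+K+x]≈-ι[1+x] K i)) ⟩
      sign (suc K ℕ.+ i) * ι (M C (suc K ℕ.+ i)) * Q (- ι (suc i))            ≈⟨ *-congˡ (*-congʳ (shiftedRising-root n i i<n)) ⟩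
      sign (suc K ℕ.+ i) * ι (M C (suc K ℕ.+ i)) * (0# * G (- ι (suc i)))     ≈⟨ trans (*-congˡ (zeroˡ _)) (zeroʳ _) ⟩
      0#                                                                     ∎)

    high : sumTo (suc r) (λ i → T (suc K ℕ.+ (n ℕ.+ i))) ≈ - (ι (n !) * sign n) * Fsum n G′ r
    high = begin
      sumTo (suc r) (λ i → T (suc K ℕ.+ (n ℕ.+ i)))            ≈⟨ sumTo-reverse (suc r) (λ i → T (suc K ℕ.+ (n ℕ.+ i))) ⟩
      sumTo (suc r) (λ i → T (suc K ℕ.+ (n ℕ.+ (r ∸ i))))      ≈⟨ sumTo-cong (suc r) (λ i i<1+r → term i (ℕ.<⇒≤pred i<1+r)) ⟩
      sumTo (suc r) (λ i → - (ι (n !) * sign n) * (sign i * ι (M C i) * ι ((r ∸ i ℕ.+ n) C n) * G′ (ι (r ∸ i))))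
        ≈⟨ *-distribˡ-sumTo (suc r) (- (ι (n !) * sign n)) _ ⟨
      - (ι (n !) * sign n) * Fsum n G′ r                       ∎
      where
      term : ∀ i → i ℕ.≤ r → T (suc K ℕ.+ (n ℕ.+ (r ∸ i))) ≈
             - (ι (n !) * sign n) * (sign i * ι (M C i) * ι ((r ∸ i ℕ.+ n) C n) * G′ (ι (r ∸ i)))
      term i i≤r = begin
        sign j * ι (M C j) * Q (ι K - ι j)                                         ≈⟨ *-cong (*-cong (sign-odd-complement {i} {j} {n} j+i≡M) (reflexive (≡.cong ι (i+j≡n⇒nCi≡nCj {j} {i} j+i≡M)))) (Q-cong w≈) ⟩
        - sign i * ι (M C i) * Q (- ι (r ∸ i) - ι (suc n))                           ≈⟨ *-congˡ (*-congʳ (shiftedRising-reflect n (ι (r ∸ i)))) ⟩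
        - sign i * ι (M C i) * (sign n * shiftedRising n (ι (r ∸ i)) * G′ (ι (r ∸ i))) ≈⟨ *-congˡ (*-congʳ (*-congˡ (shiftedRising-ι n (r ∸ i)))) ⟩
        - sign i * ι (M C i) * (sign n * (ι (n !) * ι ((r ∸ i ℕ.+ n) C n)) * G′ (ι (r ∸ i)))
          ≈⟨ solve 6 (λ s c t f b g → (:- s) :* c :* (t :* (f :* b) :* g) := :- (f :* t) :* (s :* c :* b :* g)) refl (sign i) (ι (M C i)) (sign n) (ι (n !)) _ _ ⟩
        - (ι (n !) * sign n) * (sign i * ι (M C i) * ι ((r ∸ i ℕ.+ n) C n) * G′ (ι (r ∸ i))) ∎
        where
        j = suc K ℕ.+ (n ℕ.+ (r ∸ i))
        j+i≡M : j ℕ.+ i ≡ M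
        j+i≡M = [1+K]+[n+[r∸i]]+i≡1+2n K+r≡n i≤r
        w≈ : ι K - ι j ≈ - ι (r ∸ i) - ι (suc n)
        w≈ = begin
          ι K - ι j                         ≈⟨ ι[K]-ι[1+K+x]≈-ι[1+x] K (n ℕ.+ (r ∸ i)) ⟩
          - ι (suc n ℕ.+ (r ∸ i))           ≈⟨ -‿cong (ι-+ (suc n) (r ∸ i)) ⟩
          - (ι (suc n) + ι (r ∸ i))         ≈⟨ solve 2 (λ a x → :- (a :+ x) := :- x :- a) refl (ι (suc n)) (ι (r ∸ i)) ⟩
          - ι (r ∸ i) - ι (suc n)           ∎

    ∑T-split : sumTo (suc M) T ≈ ι (n !) * Fsum n G K + (0# + - (ι (n !) * sign n) * Fsum n G′ r)
    ∑T-split = begin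
      sumTo (suc M) T                                                  ≡⟨ ≡.cong (λ m → sumTo m T) (2+2n≡[1+K]+[n+[1+r]] {K} {r} K+r≡n) ⟩
      sumTo (suc K ℕ.+ (n ℕ.+ suc r)) T                                ≈⟨ sumTo-+ (suc K) (n ℕ.+ suc r) T ⟩
      sumTo (suc K) T + sumTo (n ℕ.+ suc r) (λ j → T (suc K ℕ.+ j))    ≈⟨ +-congˡ (sumTo-+ n (suc r) (λ j → T (suc K ℕ.+ j))) ⟩
      sumTo (suc K) T + (sumTo n (λ i → T (suc K ℕ.+ i)) + sumTo (suc r) (λ i → T (suc K ℕ.+ (n ℕ.+ i))))
                                                                       ≈⟨ +-cong low (+-cong middle high) ⟩
      ι (n !) * Fsum n G K + (0# + - (ι (n !) * sign n) * Fsum n G′ r) ∎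

    n!*Fsum-reflect : ι (n !) * Fsum n G K ≈ ι (n !) * (sign n * Fsum n G′ r)
    n!*Fsum-reflect = begin
      a                                  ≈⟨ solve 3 (λ a f b → a := (a :+ (Κ0 :+ (:- f) :* b)) :+ f :* b) refl a (ι (n !) * sign n) b ⟩
      (a + (0# + - f * b)) + f * b       ≈⟨ +-congʳ (trans (sym ∑T-split) ∑T≈0) ⟩
      0# + f * b                         ≈⟨ trans (+-identityˡ _) (*-assoc _ _ _) ⟩
      ι (n !) * (sign n * b)             ∎
      where
      a = ι (n !) * Fsum n G K
      b = Fsum n G′ r
      f = ι (n !) * sign n
      Κ0 = ℤ-Solver.con (+ 0)

  x*y≈x*z⇒y≈z : ∀ x {y z} → ¬ (x ≈ 0#) → x * y ≈ x * z → y ≈ z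
  x*y≈x*z⇒y≈z x {y} {z} x≉0 xy≈xz = begin
    y                     ≈⟨ *-identityˡ y ⟨
    1# * y                ≈⟨ *-congʳ (inv-l x x≉0) ⟨
    (inv x x≉0 * x) * y   ≈⟨ *-assoc _ _ _ ⟩
    inv x x≉0 * (x * y)   ≈⟨ *-congˡ xy≈xz ⟩
    inv x x≉0 * (x * z)   ≈⟨ *-assoc _ _ _ ⟨
    (inv x x≉0 * x) * z   ≈⟨ *-congʳ (inv-l x x≉0) ⟩
    1# * z                ≈⟨ *-identityˡ z ⟩
    z                     ∎

  Fsum-reflect : ∀ {n K r} → K ℕ.+ r ≡ n → ∀ {G} → G Preserves _≈_ ⟶ _≈_ → DegreeBelow (suc n) G →
                 Fsum n G K ≈ sign n * Fsum n (λ y → G (- y - ι (suc n))) r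
  Fsum-reflect {n} {K} {r} K+r≡n G-cong G-degree =
    x*y≈x*z⇒y≈z (ι (n !)) (charZero (n !) {{n ℕ.!≢0}}) (FsumReflection.n!*Fsum-reflect {n} {K} {r} K+r≡n G-cong G-degree)

  Fsum-cong : ∀ n K {G G′ : Carrier → Carrier} → (∀ m → G (ι m) ≈ G′ (ι m)) → Fsum n G K ≈ Fsum n G′ K
  Fsum-cong n K G≈G′ = sumTo-cong (suc K) (λ j _ → *-congˡ (G≈G′ (K ∸ j)))

  *-distribˡ-Fsum : ∀ n K a G → a * Fsum n G K ≈ Fsum n (λ y → a * G y) K
  *-distribˡ-Fsum n K a G = trans (*-distribˡ-sumTo (suc K) a _) (sumTo-cong (suc K) (λ j _ →
    solve 5 (λ a s c b g → a :* (s :* c :* b :* g) := s :* c :* b :* (a :* g)) refl a _ _ _ _))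

  eval-E-Finv-J : ∀ n β (c : P≤ n) y →
    sign n * eval (Finv n c) ((- y - ι (suc n)) + ι n * - β) ≈ eval (E (ι n * β) (Finv n (J n c))) y
  eval-E-Finv-J n β c y = begin
    sign n * eval (Finv n c) ((- y - ι (suc n)) + ι n * - β)      ≈⟨ *-congˡ (eval-cong (Finv n c) reflected-shift) ⟩
    sign n * eval (Finv n c) (- (y + ι n * β) - ι (suc n))        ≈⟨ eval-Finv-J n c (y + ι n * β) ⟨
    eval (Finv n (J n c)) (y + ι n * β)                           ≈⟨ eval-E (ι n * β) (Finv n (J n c)) y ⟨
    eval (E (ι n * β) (Finv n (J n c))) y                         ∎
    where
    reflected-shift : (- y - ι (suc n)) + ι n * - β ≈ - (y + ι n * β) - ι (suc n)
    reflected-shift = solve 4 (λ y m k b → (:- y :- m) :+ k :* (:- b) := :- (y :+ k :* b) :- m) refl y (ι (suc n)) (ι n) β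

theorem7p1 : {c ℓ : Level} (𝔽 : CharZeroField c ℓ) (n : ℕ)
    (β : CommutativeRing.Carrier (CharZeroField.cring 𝔽))
    (p : Poly.P≤ 𝔽 n) (k : Fin (ℕ.suc n)) →
    CommutativeRing._≈_ (CharZeroField.cring 𝔽)
      (Poly.H 𝔽 n (CommutativeRing.-_ (CharZeroField.cring 𝔽) β) p k)
      (Poly.J 𝔽 n (Poly.H 𝔽 n β (Poly.J 𝔽 n p)) k)
theorem7p1 𝔽 n β p k = begin
  H n (- β) p k                                                          ≈⟨ F≈Fsum n (E γ₋ (Finv n p)) k ⟩
  Fsum n (eval (E γ₋ (Finv n p))) K                                      ≈⟨ Fsum-cong n K {eval (E γ₋ (Finv n p))} {λ y → eval (Finv n p) (y + γ₋)} (λ m → eval-E γ₋ (Finv n p) (ι m)) ⟩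
  Fsum n (λ y → eval (Finv n p) (y + γ₋)) K                              ≈⟨ Fsum-reflect {n} {K} {r} K+r≡n (eval-cong (Finv n p) ∘ +-congʳ) (DegreeBelow-eval-shift (Finv n p) γ₋) ⟩
  sign n * Fsum n (λ y → eval (Finv n p) ((- y - ι (suc n)) + γ₋)) r     ≈⟨ *-distribˡ-Fsum n r (sign n) (λ y → eval (Finv n p) ((- y - ι (suc n)) + γ₋)) ⟩
  Fsum n (λ y → sign n * eval (Finv n p) ((- y - ι (suc n)) + γ₋)) r     ≈⟨ Fsum-cong n r {λ y → sign n * eval (Finv n p) ((- y - ι (suc n)) + γ₋)} {eval (E γ₊ (Finv n (J n p)))} (λ m → eval-E-Finv-J n β p (ι m)) ⟩
  Fsum n (eval (E γ₊ (Finv n (J n p)))) r                                ≡⟨ ≡.cong (Fsum n (eval (E γ₊ (Finv n (J n p))))) (Fin.opposite-prop k) ⟨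
  Fsum n (eval (E γ₊ (Finv n (J n p)))) (Fin.toℕ (Fin.opposite k))       ≈⟨ F≈Fsum n (E γ₊ (Finv n (J n p))) (Fin.opposite k) ⟨
  J n (H n β (J n p)) k                                                  ∎
  where
  open CharZeroField 𝔽 using (cring)
  open CommutativeRing cring hiding (zero)
  open import Relation.Binary.Reasoning.Setoid setoid
  open Poly 𝔽
  open Embeddings cring using (ι)
  open FiniteSumsAndProducts cring using (sign)
  open Evaluation 𝔽 using (eval; eval-cong; eval-E; DegreeBelow-eval-shift)
  open Reflection 𝔽
  K = Fin.toℕ k
  r = n ∸ K
  K+r≡n : K ℕ.+ r ≡ n
  K+r≡n = ℕ.m+[n∸m]≡n (Fin.toℕ≤pred[n] k)
  γ₋ = ι n * - β
  γ₊ = ι n * β
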